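{- Every typed term is strongly normalizable: if $\Gamma \vdash M : A$ is derivable in the typing system described in the context, then there is no infinite sequence $M \triangleright M_1 \triangleright M_2 \triangleright \cdots$.
   Context: Formulas are built from propositional atoms and $\perp$ with the connectives $\rightarrow$, $\wedge$, $\vee$; $\neg A$ abbreviates $A \rightarrow \perp$. There are intuitionistic variables $x,y,\dots$ and classical variables $a,b,\dots$. Terms ${\cal T}$ and eliminators ${\cal E}$ are given by ${\cal T} ::= x \mid \lambda x\, {\cal T} \mid ({\cal T}\ {\cal E}) \mid \langle {\cal T},{\cal T}\rangle \mid \omega_1 {\cal T} \mid \omega_2 {\cal T} \mid \mu a\, {\cal T} \mid (a\ {\cal T})$ and ${\cal E} ::= {\cal T} \mid \pi_1 \mid \pi_2 \mid [x.{\cal T}, y.{\cal T}]$; $(M\ N_1 \dots N_n)$ means $((M\ N_1)\dots N_n)$. A context $\Gamma$ is a set of declarations $x : A$ and $a : \neg A$. Typing rules: $\Gamma, x:A \vdash x : A$; from $\Gamma_1 \vdash M:A$ and $\Gamma_2 \vdash N:B$ infer $\Gamma_1,\Gamma_2 \vdash \langle M,N\rangle : A\wedge B$; from $\Gamma \vdash M : A_1\wedge A_2$ infer $\Gamma \vdash (M\ \pi_i):A_i$; from $\Gamma,x:A\vdash M:B$ infer $\Gamma\vdash \lambda x M : A\rightarrow B$; from $\Gamma_1\vdash M:A\rightarrow B$ and $\Gamma_2 \vdash N:A$ infer $\Gamma_1,\Gamma_2\vdash (M\ N):B$; from $\Gamma\vdash M:A_i$ infer $\Gamma \vdash \omega_i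 M : A_1\vee A_2$; from $\Gamma\vdash M:A_1\vee A_2$, $\Gamma_1,x_1:A_1\vdash N_1:C$, $\Gamma_2,x_2:A_2\vdash N_2:C$ infer $\Gamma,\Gamma_1,\Gamma_2\vdash (M\ [x_1.N_1,x_2.N_2]):C$; from $\Gamma,a:\neg A\vdash M:\perp$ infer $\Gamma\vdash \mu a M : A$; from $\Gamma, a:\neg A\vdash M:A$ infer $\Gamma\vdash (a\ M):\perp$. A term is typed if it has a type in some context. The one-step reduction $\triangleright$ is the compatible closure (reduction allowed inside any subterm, including inside the branches of $[x.N_1,y.N_2]$) of: $(\lambda x M\ N)\triangleright M[x:=N]$; $(\langle M_1,M_2\rangle\ \pi_i)\triangleright M_i$; $(\omega_i M\ [x_1.N_1,x_2.N_2])\triangleright N_i[x_i:=M]$; $(M\ [x_1.N_1,x_2.N_2]\ \varepsilon)\triangleright (M\ [x_1.(N_1\ \varepsilon),x_2.(N_2\ \varepsilon)])$; $(\mu a M\ \varepsilon)\triangleright \mu a\, M[a:=^*\varepsilon]$, where $M[a:=^*\varepsilon]$ is obtained by replacing (recursively) each subterm of $M$ of the form $(a\ N)$ by $(a\ (N\ \varepsilon))$. $\triangleright^+$ and $\triangleright^*$ are the transitive and reflexive-transitive closures. An element is strongly normalizable ($\in SN$) if there is no infinite $\triangleright$-reduction sequence starting from it. -}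

module Defs where

open import Data.Nat using (ℕ; zero; suc)
open import Data.Fin using (Fin; zero; suc; _≟_)
open import Data.Vec using (Vec; _∷_; lookup)
open import Data.Product using (Σ; _×_)
open import Relation.Binary.PropositionalEquality using (_≡_)
open import Relation.Nullary using (¬_; yes; no)

infixr 7 _⇒_
infixr 8 _∨′_
infixr 9 _∧′_

data Form : Set where
  atom : ℕ → Form
  ⊥′   : Form
  _⇒_  : Form → Form → Form
  _∧′_ : Form → Form → Form
  _∨′_ : Form → Form → Form

¬′ : Form → Form
¬′ A = A ⇒ ⊥′

-- Terms and eliminators, well-scoped de Bruijn syntax.
-- Tm n m : terms with at most n free intuitionistic variables (x, y, …)
-- and m free classical variables (a, b, …).

data Tm (n m : ℕ) : Set
data El (n m : ℕ) : Set

data Tm n m where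
  var   : Fin n → Tm n m
  lam   : Tm (suc n) m → Tm n m
  app   : Tm n m → El n m → Tm n m
  pair  : Tm n m → Tm n m → Tm n m
  ω₁    : Tm n m → Tm n m
  ω₂    : Tm n m → Tm n m
  mu    : Tm n (suc m) → Tm n m
  throw : Fin m → Tm n m → Tm n m

data El n m where
  arg  : Tm n m → El n m
  π₁   : El n m
  π₂   : El n m
  case : Tm (suc n) m → Tm (suc n) m → El n m

ext : ∀ {k k'} → (Fin k → Fin k') → Fin (suc k) → Fin (suc k')
ext ρ zero    = zero
ext ρ (suc i) = suc (ρ i)

renT : ∀ {n n' m m'} → (Fin n → Fin n') → (Fin m → Fin m') → Tm n m → Tm n' m'
renE : ∀ {n n' m m'} → (Fin n → Fin n') → (Fin m → Fin m') → El n m → El n' m'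

renT ρ θ (var x)     = var (ρ x)
renT ρ θ (lam M)     = lam (renT (ext ρ) θ M)
renT ρ θ (app M ε)   = app (renT ρ θ M) (renE ρ θ ε)
renT ρ θ (pair M N)  = pair (renT ρ θ M) (renT ρ θ N)
renT ρ θ (ω₁ M)      = ω₁ (renT ρ θ M)
renT ρ θ (ω₂ M)      = ω₂ (renT ρ θ M)
renT ρ θ (mu M)      = mu (renT ρ (ext θ) M)
renT ρ θ (throw a M) = throw (θ a) (renT ρ θ M)

renE ρ θ (arg M)      = arg (renT ρ θ M)
renE ρ θ π₁           = π₁
renE ρ θ π₂           = π₂
renE ρ θ (case N₁ N₂) = case (renT (ext ρ) θ N₁) (renT (ext ρ) θ N₂)

wkTᵢ : ∀ {n m} → Tm n m → Tm (suc n) m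
wkTᵢ = renT suc (λ a → a)

wkEᵢ : ∀ {n m} → El n m → El (suc n) m
wkEᵢ = renE suc (λ a → a)

wkTc : ∀ {n m} → Tm n m → Tm n (suc m)
wkTc = renT (λ x → x) suc

wkEc : ∀ {n m} → El n m → El n (suc m)
wkEc = renE (λ x → x) suc

exts : ∀ {n n' m} → (Fin n → Tm n' m) → Fin (suc n) → Tm (suc n') m
exts σ zero    = var zero
exts σ (suc i) = wkTᵢ (σ i)

subT : ∀ {n n' m} → (Fin n → Tm n' m) → Tm n m → Tm n' m
subE : ∀ {n n' m} → (Fin n → Tm n' m) → El n m → El n' m

subT σ (var x)     = σ x
subT σ (lam M)     = lam (subT (exts σ) M)
subT σ (app M ε)   = app (subT σ M) (subE σ ε)
subT σ (pair M N)  = pair (subT σ M) (subT σ N)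
subT σ (ω₁ M)      = ω₁ (subT σ M)
subT σ (ω₂ M)      = ω₂ (subT σ M)
subT σ (mu M)      = mu (subT (λ x → wkTc (σ x)) M)
subT σ (throw a M) = throw a (subT σ M)

subE σ (arg M)      = arg (subT σ M)
subE σ π₁           = π₁
subE σ π₂           = π₂
subE σ (case N₁ N₂) = case (subT (exts σ) N₁) (subT (exts σ) N₂)

single : ∀ {n m} → Tm n m → Fin (suc n) → Tm n m
single N zero    = N
single N (suc i) = var i

_[0:=_] : ∀ {n m} → Tm (suc n) m → Tm n m → Tm n m
M [0:= N ] = subT (single N) M

ssubT : ∀ {n m} → Fin m → El n m → Tm n m → Tm n m
ssubE : ∀ {n m} → Fin m → El n m → El n m → El n m

ssubT a ε (var x)     = var x
ssubT a ε (lam M)     = lam (ssubT a (wkEᵢ ε) M)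
ssubT a ε (app M ε')  = app (ssubT a ε M) (ssubE a ε ε')
ssubT a ε (pair M N)  = pair (ssubT a ε M) (ssubT a ε N)
ssubT a ε (ω₁ M)      = ω₁ (ssubT a ε M)
ssubT a ε (ω₂ M)      = ω₂ (ssubT a ε M)
ssubT a ε (mu M)      = mu (ssubT (suc a) (wkEc ε) M)
ssubT a ε (throw b M) with b ≟ a
... | yes _ = throw b (app (ssubT a ε M) ε)
... | no  _ = throw b (ssubT a ε M)

ssubE a ε (arg M)      = arg (ssubT a ε M)
ssubE a ε π₁           = π₁
ssubE a ε π₂           = π₂
ssubE a ε (case N₁ N₂) = case (ssubT a (wkEᵢ ε) N₁) (ssubT a (wkEᵢ ε) N₂)

infix 4 _▷_ _▷ₑ_

data _▷_ {n m : ℕ} : Tm n m → Tm n m → Set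
data _▷ₑ_ {n m : ℕ} : El n m → El n m → Set

data _▷_ {n m} where
  β      : ∀ {M N} → app (lam M) (arg N) ▷ M [0:= N ]
  β∧₁    : ∀ {M₁ M₂} → app (pair M₁ M₂) π₁ ▷ M₁
  β∧₂    : ∀ {M₁ M₂} → app (pair M₁ M₂) π₂ ▷ M₂
  β∨₁    : ∀ {M N₁ N₂} → app (ω₁ M) (case N₁ N₂) ▷ N₁ [0:= M ]
  β∨₂    : ∀ {M N₁ N₂} → app (ω₂ M) (case N₁ N₂) ▷ N₂ [0:= M ]
  comm   : ∀ {M N₁ N₂ ε} →
           app (app M (case N₁ N₂)) ε ▷
           app M (case (app N₁ (wkEᵢ ε)) (app N₂ (wkEᵢ ε)))
  μ-red  : ∀ {M ε} → app (mu M) ε ▷ mu (ssubT zero (wkEc ε) M)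
  ξ-lam   : ∀ {M M'} → M ▷ M' → lam M ▷ lam M'
  ξ-appₗ  : ∀ {M M' ε} → M ▷ M' → app M ε ▷ app M' ε
  ξ-appᵣ  : ∀ {M ε ε'} → ε ▷ₑ ε' → app M ε ▷ app M ε'
  ξ-pairₗ : ∀ {M M' N} → M ▷ M' → pair M N ▷ pair M' N
  ξ-pairᵣ : ∀ {M N N'} → N ▷ N' → pair M N ▷ pair M N'
  ξ-ω₁    : ∀ {M M'} → M ▷ M' → ω₁ M ▷ ω₁ M'
  ξ-ω₂    : ∀ {M M'} → M ▷ M' → ω₂ M ▷ ω₂ M'
  ξ-mu    : ∀ {M M'} → M ▷ M' → mu M ▷ mu M'
  ξ-throw : ∀ {a M M'} → M ▷ M' → throw a M ▷ throw a M'

data _▷ₑ_ {n m} where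
  ξ-arg   : ∀ {M M'} → M ▷ M' → arg M ▷ₑ arg M'
  ξ-caseₗ : ∀ {N₁ N₁' N₂} → N₁ ▷ N₁' → case N₁ N₂ ▷ₑ case N₁' N₂
  ξ-caseᵣ : ∀ {N₁ N₂ N₂'} → N₂ ▷ N₂' → case N₁ N₂ ▷ₑ case N₁ N₂'

SN : ∀ {n m} → Tm n m → Set
SN {n} {m} M =
  ¬ (Σ (ℕ → Tm n m) λ f → (f 0 ≡ M) × (∀ i → f i ▷ f (suc i)))

-- Typing.  Γ gives the types of the intuitionistic variables (x : Γ x);
-- Δ gives, for each classical variable a, the formula A with a : ¬A.

infix 3 _∣_⊢_∶_

data _∣_⊢_∶_ {n m : ℕ} (Γ : Vec Form n) (Δ : Vec Form m) : Tm n m → Form → Set where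
  ax    : ∀ x → Γ ∣ Δ ⊢ var x ∶ lookup Γ x
  ∧I    : ∀ {M N A B} → Γ ∣ Δ ⊢ M ∶ A → Γ ∣ Δ ⊢ N ∶ B → Γ ∣ Δ ⊢ pair M N ∶ A ∧′ B
  ∧E₁   : ∀ {M A B} → Γ ∣ Δ ⊢ M ∶ A ∧′ B → Γ ∣ Δ ⊢ app M π₁ ∶ A
  ∧E₂   : ∀ {M A B} → Γ ∣ Δ ⊢ M ∶ A ∧′ B → Γ ∣ Δ ⊢ app M π₂ ∶ B
  ⇒I    : ∀ {M A B} → (A ∷ Γ) ∣ Δ ⊢ M ∶ B → Γ ∣ Δ ⊢ lam M ∶ A ⇒ B
  ⇒E    : ∀ {M N A B} → Γ ∣ Δ ⊢ M ∶ A ⇒ B → Γ ∣ Δ ⊢ N ∶ A → Γ ∣ Δ ⊢ app M (arg N) ∶ B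
  ∨I₁   : ∀ {M A B} → Γ ∣ Δ ⊢ M ∶ A → Γ ∣ Δ ⊢ ω₁ M ∶ A ∨′ B
  ∨I₂   : ∀ {M A B} → Γ ∣ Δ ⊢ M ∶ B → Γ ∣ Δ ⊢ ω₂ M ∶ A ∨′ B
  ∨E    : ∀ {M N₁ N₂ A B C} → Γ ∣ Δ ⊢ M ∶ A ∨′ B →
          (A ∷ Γ) ∣ Δ ⊢ N₁ ∶ C → (B ∷ Γ) ∣ Δ ⊢ N₂ ∶ C →
          Γ ∣ Δ ⊢ app M (case N₁ N₂) ∶ C
  μI    : ∀ {M A} → Γ ∣ (A ∷ Δ) ⊢ M ∶ ⊥′ → Γ ∣ Δ ⊢ mu M ∶ A
  μE    : ∀ {M} a → Γ ∣ Δ ⊢ M ∶ lookup Δ a → Γ ∣ Δ ⊢ throw a M ∶ ⊥′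

-- A term is reducible at A when, after any
-- renaming, it is strongly normalising in front of every A-stack: for A ⇒ B
-- a reducible argument followed by a B-stack, for A ∧ B a projection
-- followed by an A- or B-stack, for A ∨ B a case whose branches, instantiated
-- with reducible terms, are strongly normalising against the rest of the
-- stack, and only the empty stack at atoms and ⊥.  Stacks are what make μ
-- and the commuting conversions tractable: μa.M · π reduces only inside M or
-- π, by commutations within π, or by μ-steps absorbing π into M, which yields
-- M[a :=* π].
--
-- Every typed term is reducible under a substitution of reducible terms for
-- its intuitionistic variables and reducible stacks for its classical ones.
-- That substitution sends (a N) to (b (N · π)); renaming, ordinary and
-- structural substitution are all instances of it, so a single algebra of
-- substitution serves every commutation lemma.  Each introduction form is
-- handled by well-founded induction on the strong normalisation of its
-- components, classifying the reducts of H · π.  Variables are reducible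
-- because they are neutral, so the identity substitution gives the theorem.

module Submission where

open import Data.Nat using (ℕ; zero; suc)
open import Data.Fin using (Fin; zero; suc; _≟_)
open import Data.Vec using (Vec; _∷_; lookup)
open import Data.Vec.Functional using () renaming (_∷_ to _∷ₛ_)
open import Data.List using (List; []; _∷_; map; _++_)
open import Data.List.Properties using (map-++; map-∘; map-cong; map-id; ++-identityʳ)
open import Data.Product using (_×_; _,_)
open import Data.Bool using (true; false; if_then_else_)
open import Data.Unit using (⊤; tt)
open import Data.Empty using (⊥)
open import Function using (id; _∘_; flip)
open import Induction.WellFounded using (Acc; acc; acc-inverse)
open import Relation.Binary.Construct.Closure.ReflexiveTransitive using (Star; _◅_; gmap) renaming (ε to ε*)
open import Relation.Nullary using (does; yes; no)
open import Relation.Binary.PropositionalEquality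
open import Defs

private
  variable
    n m n' m' n'' m'' n₁ m₁ n₂ m₂ : ℕ

Stack : ℕ → ℕ → Set
Stack n m = List (El n m)

infixl 5 _·_
_·_ : Tm n m → Stack n m → Tm n m
M · []      = M
M · (ε ∷ π) = app M ε · π

·-++ : ∀ (M : Tm n m) π π' → M · (π ++ π') ≡ M · π · π'
·-++ M []      π' = refl
·-++ M (ε ∷ π) π' = ·-++ (app M ε) π π'

map-fuse : ∀ {A B C : Set} {f : B → C} {g : A → B} {h : A → C} →
  (∀ x → f (g x) ≡ h x) → ∀ xs → map f (map g xs) ≡ map h xs
map-fuse eq xs = trans (sym (map-∘ xs)) (map-cong eq xs)

map²-cong : ∀ {A B C D : Set} {f : B → C} {g : A → B} {h : D → C} {k : A → D} →
  (∀ x → f (g x) ≡ h (k x)) → ∀ xs → map f (map g xs) ≡ map h (map k xs)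
map²-cong eq xs = trans (map-fuse eq xs) (map-∘ xs)

Ren : ℕ → ℕ → Set
Ren k k' = Fin k → Fin k'

Sub : ℕ → ℕ → ℕ → Set
Sub n n' m' = Fin n → Tm n' m'

-- A continuation b ▸ π stands for the context (b (□ · π)): a classical
-- variable a sent to b ▸ π turns every subterm (a N) into (b (N · π)).
infix 4 _▸_
record Cont (n m : ℕ) : Set where
  constructor _▸_
  field
    covar   : Fin m
    pending : Stack n m
open Cont

ClSub : ℕ → ℕ → ℕ → Set
ClSub m n' m' = Fin m → Cont n' m'

renCont : Ren n n' → Ren m m' → Cont n m → Cont n' m'
renCont ρ θ (b ▸ π) = θ b ▸ map (renE ρ θ) π

idτ : ClSub m n m
idτ a = a ▸ []

renτ : Ren m m' → ClSub m n m'
renτ θ a = θ a ▸ []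

extτ : ClSub m n' m' → ClSub m (suc n') m'
extτ τ = renCont suc id ∘ τ

extsᶜ : Sub n n' m' → Sub n n' (suc m')
extsᶜ σ = wkTc ∘ σ

infixr 5 _∷τ_
_∷τ_ : Stack n' m' → ClSub m n' m' → ClSub (suc m) n' (suc m')
(π ∷τ τ) zero    = zero ▸ map wkEc π
(π ∷τ τ) (suc a) = renCont id suc (τ a)

extτᶜ : ClSub m n' m' → ClSub (suc m) n' (suc m')
extτᶜ τ = [] ∷τ τ

gsub  : Sub n n' m' → ClSub m n' m' → Tm n m → Tm n' m'
gsubₑ : Sub n n' m' → ClSub m n' m' → El n m → El n' m'
gsub σ τ (var x)     = σ x
gsub σ τ (lam M)     = lam (gsub (exts σ) (extτ τ) M)
gsub σ τ (app M ε)   = app (gsub σ τ M) (gsubₑ σ τ ε)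
gsub σ τ (pair M N)  = pair (gsub σ τ M) (gsub σ τ N)
gsub σ τ (ω₁ M)      = ω₁ (gsub σ τ M)
gsub σ τ (ω₂ M)      = ω₂ (gsub σ τ M)
gsub σ τ (mu M)      = mu (gsub (extsᶜ σ) (extτᶜ τ) M)
gsub σ τ (throw a M) = throw (covar (τ a)) (gsub σ τ M · pending (τ a))
gsubₑ σ τ (arg M)      = arg (gsub σ τ M)
gsubₑ σ τ π₁           = π₁
gsubₑ σ τ π₂           = π₂
gsubₑ σ τ (case N₁ N₂) = case (gsub (exts σ) (extτ τ) N₁) (gsub (exts σ) (extτ τ) N₂)

gsubCont : Sub n' n'' m'' → ClSub m' n'' m'' → Cont n' m' → Cont n'' m''
gsubCont σ τ (b ▸ π) = covar (τ b) ▸ map (gsubₑ σ τ) π ++ pending (τ b)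

exts-cong : ∀ {σ σ' : Sub n n' m} → σ ≗ σ' → exts σ ≗ exts σ'
exts-cong eq zero    = refl
exts-cong eq (suc x) = cong wkTᵢ (eq x)

extτᶜ-cong : ∀ {τ τ' : ClSub m n' m'} → τ ≗ τ' → extτᶜ τ ≗ extτᶜ τ'
extτᶜ-cong eq zero    = refl
extτᶜ-cong eq (suc a) = cong (renCont id suc) (eq a)

gsub-cong  : ∀ {σ σ' : Sub n n' m'} {τ τ' : ClSub m n' m'} →
  σ ≗ σ' → τ ≗ τ' → gsub σ τ ≗ gsub σ' τ'
gsubₑ-cong : ∀ {σ σ' : Sub n n' m'} {τ τ' : ClSub m n' m'} →
  σ ≗ σ' → τ ≗ τ' → gsubₑ σ τ ≗ gsubₑ σ' τ'
gsub-cong eq eq' (var x)     = eq x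
gsub-cong eq eq' (lam M)     = cong lam (gsub-cong (exts-cong eq) (cong (renCont suc id) ∘ eq') M)
gsub-cong eq eq' (app M ε)   = cong₂ app (gsub-cong eq eq' M) (gsubₑ-cong eq eq' ε)
gsub-cong eq eq' (pair M N)  = cong₂ pair (gsub-cong eq eq' M) (gsub-cong eq eq' N)
gsub-cong eq eq' (ω₁ M)      = cong ω₁ (gsub-cong eq eq' M)
gsub-cong eq eq' (ω₂ M)      = cong ω₂ (gsub-cong eq eq' M)
gsub-cong eq eq' (mu M)      = cong mu (gsub-cong (cong wkTc ∘ eq) (extτᶜ-cong eq') M)
gsub-cong eq eq' (throw a M) = cong₂ (λ c X → throw (covar c) (X · pending c)) (eq' a) (gsub-cong eq eq' M)
gsubₑ-cong eq eq' (arg M)      = cong arg (gsub-cong eq eq' M)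
gsubₑ-cong eq eq' π₁           = refl
gsubₑ-cong eq eq' π₂           = refl
gsubₑ-cong eq eq' (case N₁ N₂) =
  cong₂ case (gsub-cong (exts-cong eq) (cong (renCont suc id) ∘ eq') N₁)
             (gsub-cong (exts-cong eq) (cong (renCont suc id) ∘ eq') N₂)

gsub-· : ∀ (σ : Sub n n' m') (τ : ClSub m n' m') M π →
  gsub σ τ (M · π) ≡ gsub σ τ M · map (gsubₑ σ τ) π
gsub-· σ τ M []      = refl
gsub-· σ τ M (ε ∷ π) = gsub-· σ τ (app M ε) π

gsub-·-++ : ∀ (σ : Sub n n' m') (τ : ClSub m n' m') M π ρ →
  gsub σ τ (M · π) · ρ ≡ gsub σ τ M · (map (gsubₑ σ τ) π ++ ρ)
gsub-·-++ σ τ M π ρ =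
  trans (cong (_· ρ) (gsub-· σ τ M π)) (sym (·-++ (gsub σ τ M) (map (gsubₑ σ τ) π) ρ))

renT-· : ∀ (ρ : Ren n n') (θ : Ren m m') M π →
  renT ρ θ (M · π) ≡ renT ρ θ M · map (renE ρ θ) π
renT-· ρ θ M []      = refl
renT-· ρ θ M (ε ∷ π) = renT-· ρ θ (app M ε) π

exts-var∘ : (ρ : Ren n n') → exts {m = m} (var ∘ ρ) ≗ var ∘ ext ρ
exts-var∘ ρ zero    = refl
exts-var∘ ρ (suc x) = refl

extτᶜ-renτ : (θ : Ren m m') → extτᶜ {n' = n} (renτ θ) ≗ renτ (ext θ)
extτᶜ-renτ θ zero    = refl
extτᶜ-renτ θ (suc a) = refl

extτᶜ-id : extτᶜ (idτ {n} {m}) ≗ idτ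
extτᶜ-id zero    = refl
extτᶜ-id (suc a) = refl

renT≡gsub : (ρ : Ren n n') (θ : Ren m m') → renT ρ θ ≗ gsub (var ∘ ρ) (renτ θ)
renE≡gsub : (ρ : Ren n n') (θ : Ren m m') → renE ρ θ ≗ gsubₑ (var ∘ ρ) (renτ θ)
renT≡gsub ρ θ (var x)     = refl
renT≡gsub ρ θ (lam M)     =
  cong lam (trans (renT≡gsub (ext ρ) θ M) (sym (gsub-cong (exts-var∘ ρ) (λ _ → refl) M)))
renT≡gsub ρ θ (app M ε)   = cong₂ app (renT≡gsub ρ θ M) (renE≡gsub ρ θ ε)
renT≡gsub ρ θ (pair M N)  = cong₂ pair (renT≡gsub ρ θ M) (renT≡gsub ρ θ N)
renT≡gsub ρ θ (ω₁ M)      = cong ω₁ (renT≡gsub ρ θ M)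
renT≡gsub ρ θ (ω₂ M)      = cong ω₂ (renT≡gsub ρ θ M)
renT≡gsub ρ θ (mu M)      =
  cong mu (trans (renT≡gsub ρ (ext θ) M) (sym (gsub-cong (λ _ → refl) (extτᶜ-renτ θ) M)))
renT≡gsub ρ θ (throw a M) = cong (throw (θ a)) (renT≡gsub ρ θ M)
renE≡gsub ρ θ (arg M)      = cong arg (renT≡gsub ρ θ M)
renE≡gsub ρ θ π₁           = refl
renE≡gsub ρ θ π₂           = refl
renE≡gsub ρ θ (case N₁ N₂) =
  cong₂ case (trans (renT≡gsub (ext ρ) θ N₁) (sym (gsub-cong (exts-var∘ ρ) (λ _ → refl) N₁)))
             (trans (renT≡gsub (ext ρ) θ N₂) (sym (gsub-cong (exts-var∘ ρ) (λ _ → refl) N₂)))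

subT≡gsub : (σ : Sub n n' m) → subT σ ≗ gsub σ idτ
subE≡gsub : (σ : Sub n n' m) → subE σ ≗ gsubₑ σ idτ
subT≡gsub σ (var x)     = refl
subT≡gsub σ (lam M)     = cong lam (subT≡gsub (exts σ) M)
subT≡gsub σ (app M ε)   = cong₂ app (subT≡gsub σ M) (subE≡gsub σ ε)
subT≡gsub σ (pair M N)  = cong₂ pair (subT≡gsub σ M) (subT≡gsub σ N)
subT≡gsub σ (ω₁ M)      = cong ω₁ (subT≡gsub σ M)
subT≡gsub σ (ω₂ M)      = cong ω₂ (subT≡gsub σ M)
subT≡gsub σ (mu M)      =
  cong mu (trans (subT≡gsub (extsᶜ σ) M) (sym (gsub-cong (λ _ → refl) extτᶜ-id M)))
subT≡gsub σ (throw a M) = cong (throw a) (subT≡gsub σ M)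
subE≡gsub σ (arg M)      = cong arg (subT≡gsub σ M)
subE≡gsub σ π₁           = refl
subE≡gsub σ π₂           = refl
subE≡gsub σ (case N₁ N₂) = cong₂ case (subT≡gsub (exts σ) N₁) (subT≡gsub (exts σ) N₂)

ssubτ : Fin m → El n m → ClSub m n m
ssubτ a ε b = b ▸ (if does (b ≟ a) then ε ∷ [] else [])

extτ-ssubτ : (a : Fin m) (ε : El n m) → ssubτ a (wkEᵢ ε) ≗ extτ (ssubτ a ε)
extτ-ssubτ a ε b with does (b ≟ a)
... | true  = refl
... | false = refl

extτᶜ-ssubτ : (a : Fin m) (ε : El n m) → ssubτ (suc a) (wkEc ε) ≗ extτᶜ (ssubτ a ε)
extτᶜ-ssubτ a ε zero    = refl
extτᶜ-ssubτ a ε (suc b) with does (b ≟ a)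
... | true  = refl
... | false = refl

exts-var : exts (var {n} {m}) ≗ var
exts-var zero    = refl
exts-var (suc x) = refl

ssubT≡gsub : (a : Fin m) (ε : El n m) → ssubT a ε ≗ gsub var (ssubτ a ε)
ssubE≡gsub : (a : Fin m) (ε : El n m) → ssubE a ε ≗ gsubₑ var (ssubτ a ε)
ssubT≡gsub a ε (var x)     = refl
ssubT≡gsub a ε (lam M)     =
  cong lam (trans (ssubT≡gsub a (wkEᵢ ε) M) (gsub-cong (sym ∘ exts-var) (extτ-ssubτ a ε) M))
ssubT≡gsub a ε (app M ε')  = cong₂ app (ssubT≡gsub a ε M) (ssubE≡gsub a ε ε')
ssubT≡gsub a ε (pair M N)  = cong₂ pair (ssubT≡gsub a ε M) (ssubT≡gsub a ε N)
ssubT≡gsub a ε (ω₁ M)      = cong ω₁ (ssubT≡gsub a ε M)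
ssubT≡gsub a ε (ω₂ M)      = cong ω₂ (ssubT≡gsub a ε M)
ssubT≡gsub a ε (mu M)      =
  cong mu (trans (ssubT≡gsub (suc a) (wkEc ε) M) (gsub-cong (λ _ → refl) (extτᶜ-ssubτ a ε) M))
ssubT≡gsub a ε (throw b M) with b ≟ a
... | yes _ = cong (λ X → throw b (app X ε)) (ssubT≡gsub a ε M)
... | no  _ = cong (throw b) (ssubT≡gsub a ε M)
ssubE≡gsub a ε (arg M)      = cong arg (ssubT≡gsub a ε M)
ssubE≡gsub a ε π₁           = refl
ssubE≡gsub a ε π₂           = refl
ssubE≡gsub a ε (case N₁ N₂) =
  cong₂ case (trans (ssubT≡gsub a (wkEᵢ ε) N₁) (gsub-cong (sym ∘ exts-var) (extτ-ssubτ a ε) N₁))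
             (trans (ssubT≡gsub a (wkEᵢ ε) N₂) (gsub-cong (sym ∘ exts-var) (extτ-ssubτ a ε) N₂))

exts-∘-ext : (σ : Sub n₁ n₂ m) (ρ : Ren n n₁) → exts σ ∘ ext ρ ≗ exts (σ ∘ ρ)
exts-∘-ext σ ρ zero    = refl
exts-∘-ext σ ρ (suc x) = refl

extτᶜ-∘-ext : (τ : ClSub m₁ n m₂) (θ : Ren m m₁) → extτᶜ τ ∘ ext θ ≗ extτᶜ (τ ∘ θ)
extτᶜ-∘-ext τ θ zero    = refl
extτᶜ-∘-ext τ θ (suc a) = refl

gsub-renT  : (σ : Sub n₁ n₂ m₂) (τ : ClSub m₁ n₂ m₂) (ρ : Ren n n₁) (θ : Ren m m₁) →
  gsub σ τ ∘ renT ρ θ ≗ gsub (σ ∘ ρ) (τ ∘ θ)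
gsubₑ-renE : (σ : Sub n₁ n₂ m₂) (τ : ClSub m₁ n₂ m₂) (ρ : Ren n n₁) (θ : Ren m m₁) →
  gsubₑ σ τ ∘ renE ρ θ ≗ gsubₑ (σ ∘ ρ) (τ ∘ θ)
gsub-renT σ τ ρ θ (var x)     = refl
gsub-renT σ τ ρ θ (lam M)     =
  cong lam (trans (gsub-renT (exts σ) (extτ τ) (ext ρ) θ M) (gsub-cong (exts-∘-ext σ ρ) (λ _ → refl) M))
gsub-renT σ τ ρ θ (app M ε)   = cong₂ app (gsub-renT σ τ ρ θ M) (gsubₑ-renE σ τ ρ θ ε)
gsub-renT σ τ ρ θ (pair M N)  = cong₂ pair (gsub-renT σ τ ρ θ M) (gsub-renT σ τ ρ θ N)
gsub-renT σ τ ρ θ (ω₁ M)      = cong ω₁ (gsub-renT σ τ ρ θ M)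
gsub-renT σ τ ρ θ (ω₂ M)      = cong ω₂ (gsub-renT σ τ ρ θ M)
gsub-renT σ τ ρ θ (mu M)      =
  cong mu (trans (gsub-renT (extsᶜ σ) (extτᶜ τ) ρ (ext θ) M)
                 (gsub-cong (λ _ → refl) (extτᶜ-∘-ext τ θ) M))
gsub-renT σ τ ρ θ (throw a M) =
  cong (λ X → throw (covar (τ (θ a))) (X · pending (τ (θ a)))) (gsub-renT σ τ ρ θ M)
gsubₑ-renE σ τ ρ θ (arg M)      = cong arg (gsub-renT σ τ ρ θ M)
gsubₑ-renE σ τ ρ θ π₁           = refl
gsubₑ-renE σ τ ρ θ π₂           = refl
gsubₑ-renE σ τ ρ θ (case N₁ N₂) =
  cong₂ case (trans (gsub-renT (exts σ) (extτ τ) (ext ρ) θ N₁)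
                    (gsub-cong (exts-∘-ext σ ρ) (λ _ → refl) N₁))
             (trans (gsub-renT (exts σ) (extτ τ) (ext ρ) θ N₂)
                    (gsub-cong (exts-∘-ext σ ρ) (λ _ → refl) N₂))

renT-renT : (ρ' : Ren n' n'') (θ' : Ren m' m'') (ρ : Ren n n') (θ : Ren m m') →
  renT ρ' θ' ∘ renT ρ θ ≗ renT (ρ' ∘ ρ) (θ' ∘ θ)
renT-renT ρ' θ' ρ θ M = begin
  renT ρ' θ' (renT ρ θ M)                ≡⟨ renT≡gsub ρ' θ' (renT ρ θ M) ⟩
  gsub (var ∘ ρ') (renτ θ') (renT ρ θ M) ≡⟨ gsub-renT (var ∘ ρ') (renτ θ') ρ θ M ⟩
  gsub (var ∘ ρ' ∘ ρ) (renτ (θ' ∘ θ)) M  ≡⟨ renT≡gsub (ρ' ∘ ρ) (θ' ∘ θ) M ⟨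
  renT (ρ' ∘ ρ) (θ' ∘ θ) M               ∎
  where open ≡-Reasoning

renE-renE : (ρ' : Ren n' n'') (θ' : Ren m' m'') (ρ : Ren n n') (θ : Ren m m') →
  renE ρ' θ' ∘ renE ρ θ ≗ renE (ρ' ∘ ρ) (θ' ∘ θ)
renE-renE ρ' θ' ρ θ ε = begin
  renE ρ' θ' (renE ρ θ ε)                 ≡⟨ renE≡gsub ρ' θ' (renE ρ θ ε) ⟩
  gsubₑ (var ∘ ρ') (renτ θ') (renE ρ θ ε) ≡⟨ gsubₑ-renE (var ∘ ρ') (renτ θ') ρ θ ε ⟩
  gsubₑ (var ∘ ρ' ∘ ρ) (renτ (θ' ∘ θ)) ε  ≡⟨ renE≡gsub (ρ' ∘ ρ) (θ' ∘ θ) ε ⟨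
  renE (ρ' ∘ ρ) (θ' ∘ θ) ε                ∎
  where open ≡-Reasoning

renS-renS : (ρ' : Ren n' n'') (θ' : Ren m' m'') (ρ : Ren n n') (θ : Ren m m') →
  map (renE ρ' θ') ∘ map (renE ρ θ) ≗ map (renE (ρ' ∘ ρ) (θ' ∘ θ))
renS-renS ρ' θ' ρ θ π = trans (sym (map-∘ π)) (map-cong (renE-renE ρ' θ' ρ θ) π)

renCont-renCont : (ρ' : Ren n' n'') (θ' : Ren m' m'') (ρ : Ren n n') (θ : Ren m m') →
  renCont ρ' θ' ∘ renCont ρ θ ≗ renCont (ρ' ∘ ρ) (θ' ∘ θ)
renCont-renCont ρ' θ' ρ θ (b ▸ π) = cong (θ' (θ b) ▸_) (renS-renS ρ' θ' ρ θ π)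

exts-renT : (ρ : Ren n₁ n₂) (θ : Ren m₁ m₂) (σ : Sub n n₁ m₁) →
  renT (ext ρ) θ ∘ exts σ ≗ exts (renT ρ θ ∘ σ)
exts-renT ρ θ σ zero    = refl
exts-renT ρ θ σ (suc x) = trans (renT-renT (ext ρ) θ suc id (σ x)) (sym (renT-renT suc id ρ θ (σ x)))

extτ-renCont : (ρ : Ren n₁ n₂) (θ : Ren m₁ m₂) (τ : ClSub m n₁ m₁) →
  renCont (ext ρ) θ ∘ extτ τ ≗ extτ (renCont ρ θ ∘ τ)
extτ-renCont ρ θ τ a =
  trans (renCont-renCont (ext ρ) θ suc id (τ a)) (sym (renCont-renCont suc id ρ θ (τ a)))

extsᶜ-renT : (ρ : Ren n₁ n₂) (θ : Ren m₁ m₂) (σ : Sub n n₁ m₁) →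
  renT ρ (ext θ) ∘ extsᶜ σ ≗ extsᶜ (renT ρ θ ∘ σ)
extsᶜ-renT ρ θ σ x = trans (renT-renT ρ (ext θ) id suc (σ x)) (sym (renT-renT id suc ρ θ (σ x)))

extτᶜ-renCont : (ρ : Ren n₁ n₂) (θ : Ren m₁ m₂) (τ : ClSub m n₁ m₁) →
  renCont ρ (ext θ) ∘ extτᶜ τ ≗ extτᶜ (renCont ρ θ ∘ τ)
extτᶜ-renCont ρ θ τ zero    = refl
extτᶜ-renCont ρ θ τ (suc a) =
  trans (renCont-renCont ρ (ext θ) id suc (τ a)) (sym (renCont-renCont id suc ρ θ (τ a)))

renT-gsub  : (ρ : Ren n₁ n₂) (θ : Ren m₁ m₂) (σ : Sub n n₁ m₁) (τ : ClSub m n₁ m₁) →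
  renT ρ θ ∘ gsub σ τ ≗ gsub (renT ρ θ ∘ σ) (renCont ρ θ ∘ τ)
renE-gsubₑ : (ρ : Ren n₁ n₂) (θ : Ren m₁ m₂) (σ : Sub n n₁ m₁) (τ : ClSub m n₁ m₁) →
  renE ρ θ ∘ gsubₑ σ τ ≗ gsubₑ (renT ρ θ ∘ σ) (renCont ρ θ ∘ τ)
renT-gsub ρ θ σ τ (var x)     = refl
renT-gsub ρ θ σ τ (lam M)     =
  cong lam (trans (renT-gsub (ext ρ) θ (exts σ) (extτ τ) M)
                  (gsub-cong (exts-renT ρ θ σ) (extτ-renCont ρ θ τ) M))
renT-gsub ρ θ σ τ (app M ε)   = cong₂ app (renT-gsub ρ θ σ τ M) (renE-gsubₑ ρ θ σ τ ε)
renT-gsub ρ θ σ τ (pair M N)  = cong₂ pair (renT-gsub ρ θ σ τ M) (renT-gsub ρ θ σ τ N)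
renT-gsub ρ θ σ τ (ω₁ M)      = cong ω₁ (renT-gsub ρ θ σ τ M)
renT-gsub ρ θ σ τ (ω₂ M)      = cong ω₂ (renT-gsub ρ θ σ τ M)
renT-gsub ρ θ σ τ (mu M)      =
  cong mu (trans (renT-gsub ρ (ext θ) (extsᶜ σ) (extτᶜ τ) M)
                 (gsub-cong (extsᶜ-renT ρ θ σ) (extτᶜ-renCont ρ θ τ) M))
renT-gsub ρ θ σ τ (throw a M) =
  cong (throw (θ (covar (τ a))))
    (trans (renT-· ρ θ (gsub σ τ M) (pending (τ a)))
           (cong (_· map (renE ρ θ) (pending (τ a))) (renT-gsub ρ θ σ τ M)))
renE-gsubₑ ρ θ σ τ (arg M)      = cong arg (renT-gsub ρ θ σ τ M)
renE-gsubₑ ρ θ σ τ π₁           = refl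
renE-gsubₑ ρ θ σ τ π₂           = refl
renE-gsubₑ ρ θ σ τ (case N₁ N₂) =
  cong₂ case (trans (renT-gsub (ext ρ) θ (exts σ) (extτ τ) N₁)
                    (gsub-cong (exts-renT ρ θ σ) (extτ-renCont ρ θ τ) N₁))
             (trans (renT-gsub (ext ρ) θ (exts σ) (extτ τ) N₂)
                    (gsub-cong (exts-renT ρ θ σ) (extτ-renCont ρ θ τ) N₂))

gsub-wkTᵢ : (σ : Sub n n' m') (τ : ClSub m n' m') →
  gsub (exts σ) (extτ τ) ∘ wkTᵢ ≗ wkTᵢ ∘ gsub σ τ
gsub-wkTᵢ σ τ M = trans (gsub-renT (exts σ) (extτ τ) suc id M) (sym (renT-gsub suc id σ τ M))

gsubₑ-wkEᵢ : (σ : Sub n n' m') (τ : ClSub m n' m') →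
  gsubₑ (exts σ) (extτ τ) ∘ wkEᵢ ≗ wkEᵢ ∘ gsubₑ σ τ
gsubₑ-wkEᵢ σ τ ε = trans (gsubₑ-renE (exts σ) (extτ τ) suc id ε) (sym (renE-gsubₑ suc id σ τ ε))

gsub-wkTc : (σ : Sub n n' m') (τ : ClSub m n' m') →
  gsub (extsᶜ σ) (extτᶜ τ) ∘ wkTc ≗ wkTc ∘ gsub σ τ
gsub-wkTc σ τ M = trans (gsub-renT (extsᶜ σ) (extτᶜ τ) id suc M) (sym (renT-gsub id suc σ τ M))

gsubₑ-wkEc : (σ : Sub n n' m') (τ : ClSub m n' m') →
  gsubₑ (extsᶜ σ) (extτᶜ τ) ∘ wkEc ≗ wkEc ∘ gsubₑ σ τ
gsubₑ-wkEc σ τ ε = trans (gsubₑ-renE (extsᶜ σ) (extτᶜ τ) id suc ε) (sym (renE-gsubₑ id suc σ τ ε))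

extτ-gsubCont : (σ : Sub n₁ n₂ m₂) (τ : ClSub m₁ n₂ m₂) (c : Cont n₁ m₁) →
  gsubCont (exts σ) (extτ τ) (renCont suc id c) ≡ renCont suc id (gsubCont σ τ c)
extτ-gsubCont σ τ (b ▸ π) = cong (covar (τ b) ▸_) (begin
  map (gsubₑ (exts σ) (extτ τ)) (map wkEᵢ π) ++ map wkEᵢ (pending (τ b))
    ≡⟨ cong (_++ _) (map²-cong (gsubₑ-wkEᵢ σ τ) π) ⟩
  map wkEᵢ (map (gsubₑ σ τ) π) ++ map wkEᵢ (pending (τ b))
    ≡⟨ map-++ wkEᵢ (map (gsubₑ σ τ) π) (pending (τ b)) ⟨
  map wkEᵢ (map (gsubₑ σ τ) π ++ pending (τ b))
    ∎)
  where open ≡-Reasoning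

extτᶜ-gsubCont : (σ : Sub n₁ n₂ m₂) (τ : ClSub m₁ n₂ m₂) (c : Cont n₁ m₁) →
  gsubCont (extsᶜ σ) (extτᶜ τ) (renCont id suc c) ≡ renCont id suc (gsubCont σ τ c)
extτᶜ-gsubCont σ τ (b ▸ π) = cong (suc (covar (τ b)) ▸_) (begin
  map (gsubₑ (extsᶜ σ) (extτᶜ τ)) (map wkEc π) ++ map wkEc (pending (τ b))
    ≡⟨ cong (_++ _) (map²-cong (gsubₑ-wkEc σ τ) π) ⟩
  map wkEc (map (gsubₑ σ τ) π) ++ map wkEc (pending (τ b))
    ≡⟨ map-++ wkEc (map (gsubₑ σ τ) π) (pending (τ b)) ⟨
  map wkEc (map (gsubₑ σ τ) π ++ pending (τ b))
    ∎)
  where open ≡-Reasoning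

exts-gsub : (σ₂ : Sub n₁ n₂ m₂) (τ₂ : ClSub m₁ n₂ m₂) (σ₁ : Sub n n₁ m₁) →
  gsub (exts σ₂) (extτ τ₂) ∘ exts σ₁ ≗ exts (gsub σ₂ τ₂ ∘ σ₁)
exts-gsub σ₂ τ₂ σ₁ zero    = refl
exts-gsub σ₂ τ₂ σ₁ (suc x) = gsub-wkTᵢ σ₂ τ₂ (σ₁ x)

extτᶜ-gsub : (σ₂ : Sub n₁ n₂ m₂) (τ₂ : ClSub m₁ n₂ m₂) (τ₁ : ClSub m n₁ m₁) →
  gsubCont (extsᶜ σ₂) (extτᶜ τ₂) ∘ extτᶜ τ₁ ≗ extτᶜ (gsubCont σ₂ τ₂ ∘ τ₁)
extτᶜ-gsub σ₂ τ₂ τ₁ zero    = refl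
extτᶜ-gsub σ₂ τ₂ τ₁ (suc a) = extτᶜ-gsubCont σ₂ τ₂ (τ₁ a)

gsub-gsub   : (σ₂ : Sub n₁ n₂ m₂) (τ₂ : ClSub m₁ n₂ m₂) (σ₁ : Sub n n₁ m₁) (τ₁ : ClSub m n₁ m₁) →
  gsub σ₂ τ₂ ∘ gsub σ₁ τ₁ ≗ gsub (gsub σ₂ τ₂ ∘ σ₁) (gsubCont σ₂ τ₂ ∘ τ₁)
gsubₑ-gsubₑ : (σ₂ : Sub n₁ n₂ m₂) (τ₂ : ClSub m₁ n₂ m₂) (σ₁ : Sub n n₁ m₁) (τ₁ : ClSub m n₁ m₁) →
  gsubₑ σ₂ τ₂ ∘ gsubₑ σ₁ τ₁ ≗ gsubₑ (gsub σ₂ τ₂ ∘ σ₁) (gsubCont σ₂ τ₂ ∘ τ₁)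
gsub-gsub σ₂ τ₂ σ₁ τ₁ (var x)     = refl
gsub-gsub σ₂ τ₂ σ₁ τ₁ (lam M)     =
  cong lam (trans (gsub-gsub (exts σ₂) (extτ τ₂) (exts σ₁) (extτ τ₁) M)
                  (gsub-cong (exts-gsub σ₂ τ₂ σ₁) (extτ-gsubCont σ₂ τ₂ ∘ τ₁) M))
gsub-gsub σ₂ τ₂ σ₁ τ₁ (app M ε)   =
  cong₂ app (gsub-gsub σ₂ τ₂ σ₁ τ₁ M) (gsubₑ-gsubₑ σ₂ τ₂ σ₁ τ₁ ε)
gsub-gsub σ₂ τ₂ σ₁ τ₁ (pair M N)  =
  cong₂ pair (gsub-gsub σ₂ τ₂ σ₁ τ₁ M) (gsub-gsub σ₂ τ₂ σ₁ τ₁ N)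
gsub-gsub σ₂ τ₂ σ₁ τ₁ (ω₁ M)      = cong ω₁ (gsub-gsub σ₂ τ₂ σ₁ τ₁ M)
gsub-gsub σ₂ τ₂ σ₁ τ₁ (ω₂ M)      = cong ω₂ (gsub-gsub σ₂ τ₂ σ₁ τ₁ M)
gsub-gsub σ₂ τ₂ σ₁ τ₁ (mu M)      =
  cong mu (trans (gsub-gsub (extsᶜ σ₂) (extτᶜ τ₂) (extsᶜ σ₁) (extτᶜ τ₁) M)
                 (gsub-cong (gsub-wkTc σ₂ τ₂ ∘ σ₁) (extτᶜ-gsub σ₂ τ₂ τ₁) M))
gsub-gsub σ₂ τ₂ σ₁ τ₁ (throw a M) =
  cong (throw (covar (τ₂ (covar (τ₁ a)))))
    (trans (gsub-·-++ σ₂ τ₂ (gsub σ₁ τ₁ M) (pending (τ₁ a)) (pending (τ₂ (covar (τ₁ a)))))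
           (cong (_· pending (gsubCont σ₂ τ₂ (τ₁ a))) (gsub-gsub σ₂ τ₂ σ₁ τ₁ M)))
gsubₑ-gsubₑ σ₂ τ₂ σ₁ τ₁ (arg M)      = cong arg (gsub-gsub σ₂ τ₂ σ₁ τ₁ M)
gsubₑ-gsubₑ σ₂ τ₂ σ₁ τ₁ π₁           = refl
gsubₑ-gsubₑ σ₂ τ₂ σ₁ τ₁ π₂           = refl
gsubₑ-gsubₑ σ₂ τ₂ σ₁ τ₁ (case N₁ N₂) =
  cong₂ case (trans (gsub-gsub (exts σ₂) (extτ τ₂) (exts σ₁) (extτ τ₁) N₁)
                    (gsub-cong (exts-gsub σ₂ τ₂ σ₁) (extτ-gsubCont σ₂ τ₂ ∘ τ₁) N₁))
             (trans (gsub-gsub (exts σ₂) (extτ τ₂) (exts σ₁) (extτ τ₁) N₂)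
                    (gsub-cong (exts-gsub σ₂ τ₂ σ₁) (extτ-gsubCont σ₂ τ₂ ∘ τ₁) N₂))

gsub-id  : gsub (var {n} {m}) idτ ≗ id
gsubₑ-id : gsubₑ (var {n} {m}) idτ ≗ id
gsub-id (var x)     = refl
gsub-id (lam M)     = cong lam (trans (gsub-cong exts-var (λ _ → refl) M) (gsub-id M))
gsub-id (app M ε)   = cong₂ app (gsub-id M) (gsubₑ-id ε)
gsub-id (pair M N)  = cong₂ pair (gsub-id M) (gsub-id N)
gsub-id (ω₁ M)      = cong ω₁ (gsub-id M)
gsub-id (ω₂ M)      = cong ω₂ (gsub-id M)
gsub-id (mu M)      = cong mu (trans (gsub-cong (λ _ → refl) extτᶜ-id M) (gsub-id M))
gsub-id (throw a M) = cong (throw a) (gsub-id M)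
gsubₑ-id (arg M)      = cong arg (gsub-id M)
gsubₑ-id π₁           = refl
gsubₑ-id π₂           = refl
gsubₑ-id (case N₁ N₂) = cong₂ case (trans (gsub-cong exts-var (λ _ → refl) N₁) (gsub-id N₁))
                                   (trans (gsub-cong exts-var (λ _ → refl) N₂) (gsub-id N₂))

renT-id : renT {n} {n} {m} id id ≗ id
renT-id M = trans (renT≡gsub id id M) (gsub-id M)

renE-id : renE {n} {n} {m} id id ≗ id
renE-id ε = trans (renE≡gsub id id ε) (gsubₑ-id ε)

gsub-single-wkTᵢ : (N : Tm n m) → gsub (single N) idτ ∘ wkTᵢ ≗ id
gsub-single-wkTᵢ N M = trans (gsub-renT (single N) idτ suc id M) (gsub-id M)

gsubₑ-single-wkEᵢ : (N : Tm n m) → gsubₑ (single N) idτ ∘ wkEᵢ ≗ id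
gsubₑ-single-wkEᵢ N ε = trans (gsubₑ-renE (single N) idτ suc id ε) (gsubₑ-id ε)

gsubCont-single-wk : (N : Tm n m) (c : Cont n m) → gsubCont (single N) idτ (renCont suc id c) ≡ c
gsubCont-single-wk N (b ▸ π) =
  cong (b ▸_) (trans (++-identityʳ _) (trans (map-fuse (gsubₑ-single-wkEᵢ N) π) (map-id π)))

gsub-[0:=] : ∀ (σ : Sub n n' m') (τ : ClSub m n' m') M N →
  gsub σ τ (M [0:= N ]) ≡ gsub (gsub σ τ N ∷ₛ σ) τ M
gsub-[0:=] σ τ M N = begin
  gsub σ τ (M [0:= N ])                                 ≡⟨ cong (gsub σ τ) (subT≡gsub (single N) M) ⟩
  gsub σ τ (gsub (single N) idτ M)                      ≡⟨ gsub-gsub σ τ (single N) idτ M ⟩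
  gsub (gsub σ τ ∘ single N) (gsubCont σ τ ∘ idτ) M
    ≡⟨ gsub-cong (λ { zero → refl ; (suc x) → refl }) (λ _ → refl) M ⟩
  gsub (gsub σ τ N ∷ₛ σ) τ M                            ∎
  where open ≡-Reasoning

gsub-exts-[0:=] : ∀ (σ : Sub n n' m') (τ : ClSub m n' m') M N →
  gsub (exts σ) (extτ τ) M [0:= N ] ≡ gsub (N ∷ₛ σ) τ M
gsub-exts-[0:=] σ τ M N = begin
  gsub (exts σ) (extτ τ) M [0:= N ]
    ≡⟨ subT≡gsub (single N) (gsub (exts σ) (extτ τ) M) ⟩
  gsub (single N) idτ (gsub (exts σ) (extτ τ) M)
    ≡⟨ gsub-gsub (single N) idτ (exts σ) (extτ τ) M ⟩
  gsub (gsub (single N) idτ ∘ exts σ) (gsubCont (single N) idτ ∘ extτ τ) M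
    ≡⟨ gsub-cong (λ { zero → refl ; (suc x) → gsub-single-wkTᵢ N (σ x) })
                 (gsubCont-single-wk N ∘ τ) M ⟩
  gsub (N ∷ₛ σ) τ M                                                   ∎
  where open ≡-Reasoning

-- M [0:=* π ] performs at once the μ-steps of μ0.M against all of π:
-- each (0 N) becomes (0 (N · π)).
_[0:=*_] : Tm n (suc m) → Stack n m → Tm n (suc m)
M [0:=* π ] = gsub var (π ∷τ idτ) M

wkE-[0:=*] : (π : Stack n m) → gsubₑ var (π ∷τ idτ) ∘ wkEc ≗ wkEc
wkE-[0:=*] π ε = trans (gsubₑ-renE var (π ∷τ idτ) id suc ε) (sym (renE≡gsub id suc ε))

wkT-[0:=*] : (π : Stack n m) → gsub var (π ∷τ idτ) ∘ wkTc ≗ wkTc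
wkT-[0:=*] π M = trans (gsub-renT var (π ∷τ idτ) id suc M) (sym (renT≡gsub id suc M))

wkCont-[0:=*] : (π : Stack n m) (c : Cont n m) →
  gsubCont var (π ∷τ idτ) (renCont id suc c) ≡ renCont id suc c
wkCont-[0:=*] π (b ▸ ρ) = cong (suc b ▸_) (trans (++-identityʳ _) (map-fuse (wkE-[0:=*] π) ρ))

gsub-[0:=*] : ∀ (σ : Sub n n' m') (τ : ClSub m n' m') M π →
  gsub (extsᶜ σ) (extτᶜ τ) (M [0:=* π ]) ≡ gsub (extsᶜ σ) (map (gsubₑ σ τ) π ∷τ τ) M
gsub-[0:=*] σ τ M π =
  trans (gsub-gsub (extsᶜ σ) (extτᶜ τ) var (π ∷τ idτ) M) (gsub-cong (λ _ → refl) pointwise M)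
  where
  pointwise : gsubCont (extsᶜ σ) (extτᶜ τ) ∘ (π ∷τ idτ) ≗ map (gsubₑ σ τ) π ∷τ τ
  pointwise zero    = cong (zero ▸_) (trans (++-identityʳ _) (map²-cong (gsubₑ-wkEc σ τ) π))
  pointwise (suc a) = refl

gsub-extsᶜ-[0:=*] : ∀ (σ : Sub n n' m') (τ : ClSub m n' m') M π →
  gsub (extsᶜ σ) (extτᶜ τ) M [0:=* π ] ≡ gsub (extsᶜ σ) (π ∷τ τ) M
gsub-extsᶜ-[0:=*] σ τ M π =
  trans (gsub-gsub var (π ∷τ idτ) (extsᶜ σ) (extτᶜ τ) M) (gsub-cong (wkT-[0:=*] π ∘ σ) pointwise M)
  where
  pointwise : gsubCont var (π ∷τ idτ) ∘ extτᶜ τ ≗ π ∷τ τ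
  pointwise zero    = refl
  pointwise (suc a) = wkCont-[0:=*] π (τ a)

ssubT0≡[0:=*] : ∀ (ε : El n m) M → ssubT zero (wkEc ε) M ≡ M [0:=* ε ∷ [] ]
ssubT0≡[0:=*] ε M =
  trans (ssubT≡gsub zero (wkEc ε) M) (gsub-cong (λ _ → refl) (λ { zero → refl ; (suc a) → refl }) M)

[0:=*]-∷ : ∀ (ε : El n m) π M → M [0:=* ε ∷ π ] ≡ ssubT zero (wkEc ε) M [0:=* π ]
[0:=*]-∷ ε π M = sym (begin
  ssubT zero (wkEc ε) M [0:=* π ]                          ≡⟨ cong _[0:=* π ] (ssubT0≡[0:=*] ε M) ⟩
  gsub var (π ∷τ idτ) (gsub var ((ε ∷ []) ∷τ idτ) M)        ≡⟨ gsub-gsub var (π ∷τ idτ) var _ M ⟩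
  gsub var (gsubCont var (π ∷τ idτ) ∘ ((ε ∷ []) ∷τ idτ)) M ≡⟨ gsub-cong (λ _ → refl) pointwise M ⟩
  M [0:=* ε ∷ π ]                                          ∎)
  where
  open ≡-Reasoning
  pointwise : gsubCont var (π ∷τ idτ) ∘ ((ε ∷ []) ∷τ idτ) ≗ (ε ∷ π) ∷τ idτ
  pointwise zero    = cong (λ ε' → zero ▸ ε' ∷ map wkEc π) (wkE-[0:=*] π ε)
  pointwise (suc a) = refl

gsub-[0:=]-comm : ∀ (σ : Sub n n' m') (τ : ClSub m n' m') M N →
  gsub σ τ (M [0:= N ]) ≡ gsub (exts σ) (extτ τ) M [0:= gsub σ τ N ]
gsub-[0:=]-comm σ τ M N = trans (gsub-[0:=] σ τ M N) (sym (gsub-exts-[0:=] σ τ M (gsub σ τ N)))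

gsub-ssubT0-comm : ∀ (σ : Sub n n' m') (τ : ClSub m n' m') M ε →
  gsub (extsᶜ σ) (extτᶜ τ) (ssubT zero (wkEc ε) M) ≡
  ssubT zero (wkEc (gsubₑ σ τ ε)) (gsub (extsᶜ σ) (extτᶜ τ) M)
gsub-ssubT0-comm σ τ M ε = begin
  gsub (extsᶜ σ) (extτᶜ τ) (ssubT zero (wkEc ε) M)
    ≡⟨ cong (gsub (extsᶜ σ) (extτᶜ τ)) (ssubT0≡[0:=*] ε M) ⟩
  gsub (extsᶜ σ) (extτᶜ τ) (M [0:=* ε ∷ [] ])
    ≡⟨ gsub-[0:=*] σ τ M (ε ∷ []) ⟩
  gsub (extsᶜ σ) ((gsubₑ σ τ ε ∷ []) ∷τ τ) M
    ≡⟨ gsub-extsᶜ-[0:=*] σ τ M (gsubₑ σ τ ε ∷ []) ⟨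
  gsub (extsᶜ σ) (extτᶜ τ) M [0:=* gsubₑ σ τ ε ∷ [] ]
    ≡⟨ ssubT0≡[0:=*] (gsubₑ σ τ ε) (gsub (extsᶜ σ) (extτᶜ τ) M) ⟨
  ssubT zero (wkEc (gsubₑ σ τ ε)) (gsub (extsᶜ σ) (extτᶜ τ) M)
    ∎
  where open ≡-Reasoning

▷-respʳ-≡ : ∀ {M N N' : Tm n m} → N ≡ N' → M ▷ N → M ▷ N'
▷-respʳ-≡ refl r = r

comm-≡ : ∀ {M : Tm n m} {N₁ N₂ ε ε'} → ε' ≡ wkEᵢ ε →
  app (app M (case N₁ N₂)) ε ▷ app M (case (app N₁ ε') (app N₂ ε'))
comm-≡ refl = comm

·-▷ : ∀ {M M' : Tm n m} π → M ▷ M' → M · π ▷ M' · π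
·-▷ []      r = r
·-▷ (ε ∷ π) r = ·-▷ π (ξ-appₗ r)

gsub-▷  : ∀ (σ : Sub n n' m') (τ : ClSub m n' m') {M M' : Tm n m} →
  M ▷ M' → gsub σ τ M ▷ gsub σ τ M'
gsubₑ-▷ : ∀ (σ : Sub n n' m') (τ : ClSub m n' m') {ε ε' : El n m} →
  ε ▷ₑ ε' → gsubₑ σ τ ε ▷ₑ gsubₑ σ τ ε'
gsub-▷ σ τ (β {M} {N})                  = ▷-respʳ-≡ (sym (gsub-[0:=]-comm σ τ M N)) β
gsub-▷ σ τ β∧₁                          = β∧₁
gsub-▷ σ τ β∧₂                          = β∧₂
gsub-▷ σ τ (β∨₁ {M} {N₁})               = ▷-respʳ-≡ (sym (gsub-[0:=]-comm σ τ N₁ M)) β∨₁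
gsub-▷ σ τ (β∨₂ {M} {N₂ = N₂})          = ▷-respʳ-≡ (sym (gsub-[0:=]-comm σ τ N₂ M)) β∨₂
gsub-▷ σ τ (comm {ε = ε})               = comm-≡ (gsubₑ-wkEᵢ σ τ ε)
gsub-▷ σ τ (μ-red {M} {ε})              = ▷-respʳ-≡ (cong mu (sym (gsub-ssubT0-comm σ τ M ε))) μ-red
gsub-▷ σ τ (ξ-lam r)   = ξ-lam (gsub-▷ (exts σ) (extτ τ) r)
gsub-▷ σ τ (ξ-appₗ r)  = ξ-appₗ (gsub-▷ σ τ r)
gsub-▷ σ τ (ξ-appᵣ r)  = ξ-appᵣ (gsubₑ-▷ σ τ r)
gsub-▷ σ τ (ξ-pairₗ r) = ξ-pairₗ (gsub-▷ σ τ r)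
gsub-▷ σ τ (ξ-pairᵣ r) = ξ-pairᵣ (gsub-▷ σ τ r)
gsub-▷ σ τ (ξ-ω₁ r)    = ξ-ω₁ (gsub-▷ σ τ r)
gsub-▷ σ τ (ξ-ω₂ r)    = ξ-ω₂ (gsub-▷ σ τ r)
gsub-▷ σ τ (ξ-mu r)    = ξ-mu (gsub-▷ (extsᶜ σ) (extτᶜ τ) r)
gsub-▷ σ τ (ξ-throw {a} r) = ξ-throw (·-▷ (pending (τ a)) (gsub-▷ σ τ r))
gsubₑ-▷ σ τ (ξ-arg r)   = ξ-arg (gsub-▷ σ τ r)
gsubₑ-▷ σ τ (ξ-caseₗ r) = ξ-caseₗ (gsub-▷ (exts σ) (extτ τ) r)
gsubₑ-▷ σ τ (ξ-caseᵣ r) = ξ-caseᵣ (gsub-▷ (exts σ) (extτ τ) r)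

renT-▷ : ∀ (ρ : Ren n n') (θ : Ren m m') {M M' : Tm n m} → M ▷ M' → renT ρ θ M ▷ renT ρ θ M'
renT-▷ ρ θ {M} {M'} r =
  subst₂ _▷_ (sym (renT≡gsub ρ θ M)) (sym (renT≡gsub ρ θ M')) (gsub-▷ (var ∘ ρ) (renτ θ) r)

renE-▷ : ∀ (ρ : Ren n n') (θ : Ren m m') {ε ε' : El n m} → ε ▷ₑ ε' → renE ρ θ ε ▷ₑ renE ρ θ ε'
renE-▷ ρ θ {ε} {ε'} r =
  subst₂ _▷ₑ_ (sym (renE≡gsub ρ θ ε)) (sym (renE≡gsub ρ θ ε')) (gsubₑ-▷ (var ∘ ρ) (renτ θ) r)

[0:=]-▷ : ∀ {M M' : Tm (suc n) m} (N : Tm n m) → M ▷ M' → M [0:= N ] ▷ M' [0:= N ]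
[0:=]-▷ {M = M} {M'} N r =
  subst₂ _▷_ (sym (subT≡gsub (single N) M)) (sym (subT≡gsub (single N) M')) (gsub-▷ (single N) idτ r)

infix 4 _⇝_
data _⇝_ {n m} : Stack n m → Stack n m → Set where
  here  : ∀ {ε ε' π} → ε ▷ₑ ε' → ε ∷ π ⇝ ε' ∷ π
  there : ∀ {ε π π'} → π ⇝ π' → ε ∷ π ⇝ ε ∷ π'
  comm  : ∀ {N₁ N₂ ε π} → case N₁ N₂ ∷ ε ∷ π ⇝ case (app N₁ (wkEᵢ ε)) (app N₂ (wkEᵢ ε)) ∷ π

⇝-comm-≡ : ∀ {N₁ N₂ : Tm (suc n) m} {ε ε' π} → ε' ≡ wkEᵢ ε →
  case N₁ N₂ ∷ ε ∷ π ⇝ case (app N₁ ε') (app N₂ ε') ∷ π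
⇝-comm-≡ refl = comm

⇝-▷ : ∀ (M : Tm n m) {π π'} → π ⇝ π' → M · π ▷ M · π'
⇝-▷ M {ε ∷ π}     (here r)  = ·-▷ π (ξ-appᵣ r)
⇝-▷ M             (there s) = ⇝-▷ (app M _) s
⇝-▷ M {_ ∷ _ ∷ π} comm      = ·-▷ π comm

renS-⇝ : ∀ (ρ : Ren n n') (θ : Ren m m') {π π' : Stack n m} →
  π ⇝ π' → map (renE ρ θ) π ⇝ map (renE ρ θ) π'
renS-⇝ ρ θ (here r)  = here (renE-▷ ρ θ r)
renS-⇝ ρ θ (there s) = there (renS-⇝ ρ θ s)
renS-⇝ ρ θ (comm {ε = ε}) =
  ⇝-comm-≡ (trans (renE-renE (ext ρ) θ suc id ε) (sym (renE-renE suc id ρ θ ε)))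

infix 4 _▷ᵣ_
data _▷ᵣ_ {n m} : Tm n m → Tm n m → Set where
  β     : ∀ {M N} → app (lam M) (arg N) ▷ᵣ M [0:= N ]
  β∧₁   : ∀ {M₁ M₂} → app (pair M₁ M₂) π₁ ▷ᵣ M₁
  β∧₂   : ∀ {M₁ M₂} → app (pair M₁ M₂) π₂ ▷ᵣ M₂
  β∨₁   : ∀ {M N₁ N₂} → app (ω₁ M) (case N₁ N₂) ▷ᵣ N₁ [0:= M ]
  β∨₂   : ∀ {M N₁ N₂} → app (ω₂ M) (case N₁ N₂) ▷ᵣ N₂ [0:= M ]
  μ-red : ∀ {M ε} → app (mu M) ε ▷ᵣ mu (ssubT zero (wkEc ε) M)

data Reduct {n m} : Tm n m → Stack n m → Tm n m → Set where
  head    : ∀ {H H' π} → H ▷ H' → Reduct H π (H' · π)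
  stack   : ∀ {H π π'} → π ⇝ π' → Reduct H π (H · π')
  redex   : ∀ {H ε π Z} → app H ε ▷ᵣ Z → Reduct H (ε ∷ π) (Z · π)
  commute : ∀ {M N₁ N₂ ε π} →
    Reduct (app M (case N₁ N₂)) (ε ∷ π) (app M (case (app N₁ (wkEᵢ ε)) (app N₂ (wkEᵢ ε))) · π)

reduct : ∀ (H : Tm n m) π {Y} → H · π ▷ Y → Reduct H π Y
reduct H []      r = head r
reduct H (ε ∷ π) r with reduct (app H ε) π r
... | head (ξ-appₗ r) = head r
... | head (ξ-appᵣ r) = stack (here r)
... | head β          = redex β
... | head β∧₁        = redex β∧₁
... | head β∧₂        = redex β∧₂
... | head β∨₁        = redex β∨₁
... | head β∨₂        = redex β∨₂
... | head μ-red      = redex μ-red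
... | head comm       = commute
... | stack s         = stack (there s)
... | redex ()
... | commute         = stack comm

Sn : Tm n m → Set
Sn = Acc (flip _▷_)

Sn⇒SN : ∀ {M : Tm n m} → Sn M → SN M
Sn⇒SN (acc h) (f , refl , steps) = Sn⇒SN (h (steps 0)) (f ∘ suc , refl , steps ∘ suc)

Sn-lam : ∀ {M : Tm (suc n) m} → Sn M → Sn (lam M)
Sn-lam (acc h) = acc λ { (ξ-lam r) → Sn-lam (h r) }

Sn-pair : ∀ {M N : Tm n m} → Sn M → Sn N → Sn (pair M N)
Sn-pair (acc h) (acc k) = acc λ where
  (ξ-pairₗ r) → Sn-pair (h r) (acc k)
  (ξ-pairᵣ r) → Sn-pair (acc h) (k r)

Sn-ω₁ : ∀ {M : Tm n m} → Sn M → Sn (ω₁ M)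
Sn-ω₁ (acc h) = acc λ { (ξ-ω₁ r) → Sn-ω₁ (h r) }

Sn-ω₂ : ∀ {M : Tm n m} → Sn M → Sn (ω₂ M)
Sn-ω₂ (acc h) = acc λ { (ξ-ω₂ r) → Sn-ω₂ (h r) }

Sn-throw : ∀ {a : Fin m} {M : Tm n m} → Sn M → Sn (throw a M)
Sn-throw (acc h) = acc λ { (ξ-throw r) → Sn-throw (h r) }

data Ne {n m} : Tm n m → Set where
  var : ∀ x → Ne (var x)
  app : ∀ {H N} → Ne H → Ne (app H (arg N))
  π₁  : ∀ {H} → Ne H → Ne (app H π₁)
  π₂  : ∀ {H} → Ne H → Ne (app H π₂)

Ne-▷ : ∀ {H H' : Tm n m} → Ne H → H ▷ H' → Ne H'
Ne-▷ (app ne) (ξ-appₗ r)         = app (Ne-▷ ne r)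
Ne-▷ (app ne) (ξ-appᵣ (ξ-arg r)) = app ne
Ne-▷ (π₁ ne)  (ξ-appₗ r)         = π₁ (Ne-▷ ne r)
Ne-▷ (π₂ ne)  (ξ-appₗ r)         = π₂ (Ne-▷ ne r)

Sn-Ne-app : ∀ {H N : Tm n m} → Ne H → Sn H → Sn N → Sn (app H (arg N))
Sn-Ne-app ne (acc h) (acc k) = acc λ where
  (ξ-appₗ r)         → Sn-Ne-app (Ne-▷ ne r) (h r) (acc k)
  (ξ-appᵣ (ξ-arg r)) → Sn-Ne-app ne (acc h) (k r)

Sn-Ne-π₁ : ∀ {H : Tm n m} → Ne H → Sn H → Sn (app H π₁)
Sn-Ne-π₁ ne (acc h) = acc λ { (ξ-appₗ r) → Sn-Ne-π₁ (Ne-▷ ne r) (h r) }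

Sn-Ne-π₂ : ∀ {H : Tm n m} → Ne H → Sn H → Sn (app H π₂)
Sn-Ne-π₂ ne (acc h) = acc λ { (ξ-appₗ r) → Sn-Ne-π₂ (Ne-▷ ne r) (h r) }

-- ⟦ A ⟧ quantifies over renamings to be stable under the weakenings that
-- case branches and μ-bound stacks go through.
⟦_⟧   : Form → ∀ {n m} → Tm n m → Set
⟦_⟧⊥  : Form → ∀ {n m} → Tm n m → Set
⟦_⟧ˢ  : Form → ∀ {n m} → Stack n m → Set
Branch : Form → ∀ {n m} → Tm (suc n) m → Stack n m → Set

⟦ A ⟧ {n} {m} M = ∀ {n' m'} (ρ : Ren n n') (θ : Ren m m') → ⟦ A ⟧⊥ (renT ρ θ M)

⟦ A ⟧⊥ M = ∀ π → ⟦ A ⟧ˢ π → Sn (M · π)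

⟦ A ⟧ˢ      []                 = ⊤
⟦ A ⇒ B ⟧ˢ  (arg N ∷ π)        = ⟦ A ⟧ N × ⟦ B ⟧ˢ π
⟦ A ∧′ B ⟧ˢ (π₁ ∷ π)           = ⟦ A ⟧ˢ π
⟦ A ∧′ B ⟧ˢ (π₂ ∷ π)           = ⟦ B ⟧ˢ π
⟦ A ∨′ B ⟧ˢ (case N₁ N₂ ∷ π)   = Branch A N₁ π × Branch B N₂ π
⟦ _ ⟧ˢ      (_ ∷ _)            = ⊥

Branch A {n} {m} N π = ∀ {n' m'} (ρ : Ren n n') (θ : Ren m m') P → ⟦ A ⟧ P →
  Sn (gsub (P ∷ₛ var ∘ ρ) (renτ θ) N · map (renE ρ θ) π)

⟦⟧⇒⟦⟧⊥ : ∀ A {M : Tm n m} → ⟦ A ⟧ M → ⟦ A ⟧⊥ M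
⟦⟧⇒⟦⟧⊥ A {M = M} p π q = subst (λ M' → Sn (M' · π)) (renT-id M) (p id id π q)

⟦⟧⇒Sn : ∀ A {M : Tm n m} → ⟦ A ⟧ M → Sn M
⟦⟧⇒Sn A p = ⟦⟧⇒⟦⟧⊥ A p [] tt

⟦⟧-renT : ∀ A (ρ : Ren n n') (θ : Ren m m') {M : Tm n m} → ⟦ A ⟧ M → ⟦ A ⟧ (renT ρ θ M)
⟦⟧-renT A ρ θ {M} p ρ' θ' π q =
  subst (λ M' → Sn (M' · π)) (sym (renT-renT ρ' θ' ρ θ M)) (p (ρ' ∘ ρ) (θ' ∘ θ) π q)

Branch-ren : ∀ A (ρ : Ren n n') (θ : Ren m m') {N : Tm (suc n) m} {π} →
  Branch A N π → Branch A (renT (ext ρ) θ N) (map (renE ρ θ) π)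
Branch-ren A ρ θ {N} {π} k ρ' θ' P p =
  subst₂ (λ N' π' → Sn (N' · π'))
    (sym (trans (gsub-renT (P ∷ₛ var ∘ ρ') (renτ θ') (ext ρ) θ N)
                (gsub-cong (λ { zero → refl ; (suc x) → refl }) (λ _ → refl) N)))
    (sym (renS-renS ρ' θ' ρ θ π))
    (k (ρ' ∘ ρ) (θ' ∘ θ) P p)

⟦⟧ˢ-renS : ∀ A (ρ : Ren n n') (θ : Ren m m') (π : Stack n m) → ⟦ A ⟧ˢ π → ⟦ A ⟧ˢ (map (renE ρ θ) π)
⟦⟧ˢ-renS A        ρ θ []               q         = tt
⟦⟧ˢ-renS (A ⇒ B)  ρ θ (arg N ∷ π)      (p , q)   = ⟦⟧-renT A ρ θ p , ⟦⟧ˢ-renS B ρ θ π q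
⟦⟧ˢ-renS (A ∧′ B) ρ θ (π₁ ∷ π)         q         = ⟦⟧ˢ-renS A ρ θ π q
⟦⟧ˢ-renS (A ∧′ B) ρ θ (π₂ ∷ π)         q         = ⟦⟧ˢ-renS B ρ θ π q
⟦⟧ˢ-renS (A ∨′ B) ρ θ (case N₁ N₂ ∷ π) (k₁ , k₂) =
  Branch-ren A ρ θ {N₁} {π} k₁ , Branch-ren B ρ θ {N₂} {π} k₂

⟦⟧-▷ : ∀ A {M M' : Tm n m} → ⟦ A ⟧ M → M ▷ M' → ⟦ A ⟧ M'
⟦⟧-▷ A p r ρ θ π q = acc-inverse (p ρ θ π q) (·-▷ π (renT-▷ ρ θ r))

Branch-▷ : ∀ A {N N' : Tm (suc n) m} {π} → Branch A N π → N ▷ N' → Branch A N' π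
Branch-▷ A {π = π} k r ρ θ P p = acc-inverse (k ρ θ P p) (·-▷ (map (renE ρ θ) π) (gsub-▷ _ _ r))

Branch-⇝ : ∀ A {N : Tm (suc n) m} {π π'} → Branch A N π → π ⇝ π' → Branch A N π'
Branch-⇝ A k s ρ θ P p = acc-inverse (k ρ θ P p) (⇝-▷ _ (renS-⇝ ρ θ s))

gsubₑ-∷ₛ-wkEᵢ : ∀ (ρ : Ren n n') (θ : Ren m m') P ε →
  gsubₑ (P ∷ₛ var ∘ ρ) (renτ θ) (wkEᵢ ε) ≡ renE ρ θ ε
gsubₑ-∷ₛ-wkEᵢ ρ θ P ε = trans (gsubₑ-renE (P ∷ₛ var ∘ ρ) (renτ θ) suc id ε) (sym (renE≡gsub ρ θ ε))

Branch-comm : ∀ A {N : Tm (suc n) m} {ε π} → Branch A N (ε ∷ π) → Branch A (app N (wkEᵢ ε)) π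
Branch-comm A {N = N} {ε} {π} k ρ θ P p =
  subst (λ ε' → Sn (app (gsub (P ∷ₛ var ∘ ρ) (renτ θ) N) ε' · map (renE ρ θ) π))
        (sym (gsubₑ-∷ₛ-wkEᵢ ρ θ P ε))
        (k ρ θ P p)

⟦⟧ˢ-⇝ : ∀ A {π π' : Stack n m} → ⟦ A ⟧ˢ π → π ⇝ π' → ⟦ A ⟧ˢ π'
⟦⟧ˢ-⇝ (A ⇒ B)  {π = arg N ∷ π} (p , q) (here (ξ-arg r)) = ⟦⟧-▷ A p r , q
⟦⟧ˢ-⇝ (A ⇒ B)  {π = arg N ∷ π} (p , q) (there s)        = p , ⟦⟧ˢ-⇝ B q s
⟦⟧ˢ-⇝ (A ∧′ B) {π = π₁ ∷ π}    q       (there s)        = ⟦⟧ˢ-⇝ A q s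
⟦⟧ˢ-⇝ (A ∧′ B) {π = π₂ ∷ π}    q       (there s)        = ⟦⟧ˢ-⇝ B q s
⟦⟧ˢ-⇝ (A ∨′ B) {π = case N₁ N₂ ∷ π} (k₁ , k₂) (here (ξ-caseₗ r)) = Branch-▷ A {π = π} k₁ r , k₂
⟦⟧ˢ-⇝ (A ∨′ B) {π = case N₁ N₂ ∷ π} (k₁ , k₂) (here (ξ-caseᵣ r)) = k₁ , Branch-▷ B {π = π} k₂ r
⟦⟧ˢ-⇝ (A ∨′ B) {π = case N₁ N₂ ∷ π} (k₁ , k₂) (there s) =
  Branch-⇝ A {N = N₁} k₁ s , Branch-⇝ B {N = N₂} k₂ s
⟦⟧ˢ-⇝ (A ∨′ B) {π = case N₁ N₂ ∷ ε ∷ π} (k₁ , k₂) comm =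
  Branch-comm A {N = N₁} {ε} {π} k₁ , Branch-comm B {N = N₂} {ε} {π} k₂

⟦⟧ˢ-⇝* : ∀ A {π π' : Stack n m} → ⟦ A ⟧ˢ π → Star _⇝_ π π' → ⟦ A ⟧ˢ π'
⟦⟧ˢ-⇝* A q ε*       = q
⟦⟧ˢ-⇝* A q (s ◅ ss) = ⟦⟧ˢ-⇝* A (⟦⟧ˢ-⇝ A q s) ss

Sn-Ne-case : ∀ {H : Tm n m} {N₁ N₂} π → Ne H → Sn H →
  Sn (N₁ · map wkEᵢ π) → Sn (N₂ · map wkEᵢ π) → Sn (app H (case N₁ N₂) · π)
Sn-Ne-case π ne sH s₁ s₂ = acc λ r → go ne sH s₁ s₂ (reduct _ π r)
  where
  go : ∀ {n m} {H : Tm n m} {N₁ N₂ π Y} → Ne H → Sn H →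
    Sn (N₁ · map wkEᵢ π) → Sn (N₂ · map wkEᵢ π) → Reduct (app H (case N₁ N₂)) π Y → Sn Y
  go {π = π} ne (acc h) s₁ s₂ (head (ξ-appₗ r)) = Sn-Ne-case π (Ne-▷ ne r) (h r) s₁ s₂
  go {π = π} ne sH (acc k₁) s₂ (head (ξ-appᵣ (ξ-caseₗ r))) =
    Sn-Ne-case π ne sH (k₁ (·-▷ (map wkEᵢ π) r)) s₂
  go {π = π} ne sH s₁ (acc k₂) (head (ξ-appᵣ (ξ-caseᵣ r))) =
    Sn-Ne-case π ne sH s₁ (k₂ (·-▷ (map wkEᵢ π) r))
  go {N₁ = N₁} {N₂} ne sH (acc k₁) (acc k₂) (stack {π' = π'} s) =
    Sn-Ne-case π' ne sH (k₁ (⇝-▷ N₁ (renS-⇝ suc id s))) (k₂ (⇝-▷ N₂ (renS-⇝ suc id s)))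
  go ne sH s₁ s₂ (commute {π = π}) = Sn-Ne-case π ne sH s₁ s₂

Sn-Ne      : ∀ A {H : Tm n m} π → Ne H → Sn H → ⟦ A ⟧ˢ π → Sn (H · π)
var∈⟦⟧     : ∀ A (x : Fin n) → ⟦ A ⟧ (var {m = m} x)
Branch⇒Sn : ∀ A {N : Tm (suc n) m} π → Branch A N π → Sn (N · map wkEᵢ π)

Sn-Ne A        []                 ne sH q         = sH
Sn-Ne (A ⇒ B)  (arg N ∷ π)        ne sH (p , q)   = Sn-Ne B π (app ne) (Sn-Ne-app ne sH (⟦⟧⇒Sn A p)) q
Sn-Ne (A ∧′ B) (π₁ ∷ π)           ne sH q         = Sn-Ne A π (π₁ ne) (Sn-Ne-π₁ ne sH) q
Sn-Ne (A ∧′ B) (π₂ ∷ π)           ne sH q         = Sn-Ne B π (π₂ ne) (Sn-Ne-π₂ ne sH) q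
Sn-Ne (A ∨′ B) (case N₁ N₂ ∷ π)   ne sH (k₁ , k₂) =
  Sn-Ne-case π ne sH (Branch⇒Sn A π k₁) (Branch⇒Sn B π k₂)

var∈⟦⟧ A x ρ θ π q = Sn-Ne A π (var (ρ x)) (acc λ ()) q

Branch⇒Sn A {N = N} π k =
  subst (λ N' → Sn (N' · map wkEᵢ π))
        (trans (gsub-cong (λ { zero → refl ; (suc x) → refl }) (λ _ → refl) N) (gsub-id N))
        (k suc id (var zero) (var∈⟦⟧ A zero))

SnInst : Form → Tm (suc n) m → Stack n m → Set
SnInst A N π = ∀ P → ⟦ A ⟧ P → Sn (N [0:= P ] · π)

Branch⇒SnInst : ∀ A (N : Tm (suc n) m) π → Branch A N π → SnInst A N π
Branch⇒SnInst A N π k P p =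
  subst₂ (λ N' π' → Sn (N' · π'))
    (trans (gsub-cong (λ { zero → refl ; (suc x) → refl }) (λ _ → refl) N) (sym (subT≡gsub (single P) N)))
    (trans (map-cong renE-id π) (map-id π))
    (k id id P p)

wkEᵢ-[0:=] : ∀ (N : Tm n m) ε → subE (single N) (wkEᵢ ε) ≡ ε
wkEᵢ-[0:=] N ε = trans (subE≡gsub (single N) (wkEᵢ ε)) (gsubₑ-single-wkEᵢ N ε)

Sn-β : ∀ A (M : Tm (suc n) m) N π → ⟦ A ⟧ N → SnInst A M π → Sn (lam M · (arg N ∷ π))
Sn-β A M N π p k = go M N π p (⟦⟧⇒Sn A p) (k N p) k
  where
  go   : ∀ M N π → ⟦ A ⟧ N → Sn N → Sn (M [0:= N ] · π) → SnInst A M π → Sn (lam M · (arg N ∷ π))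
  step : ∀ {M N π Y} → ⟦ A ⟧ N → Sn N → Sn (M [0:= N ] · π) → SnInst A M π →
    Reduct (lam M) (arg N ∷ π) Y → Sn Y
  go M N π p sN sMN k = acc λ r → step p sN sMN k (reduct (lam M) (arg N ∷ π) r)
  step {N = N} {π} p sN (acc h) k (head (ξ-lam {M' = M'} r)) =
    go M' N π p sN (h (·-▷ π ([0:=]-▷ N r))) (λ N' p' → acc-inverse (k N' p') (·-▷ π ([0:=]-▷ N' r)))
  step {M} {π = π} p (acc h) sMN k (stack (here (ξ-arg {M' = N'} r))) =
    go M N' π (⟦⟧-▷ A p r) (h r) (k N' (⟦⟧-▷ A p r)) k
  step {M} {N} p sN (acc h) k (stack (there {π' = π'} s)) =
    go M N π' p sN (h (⇝-▷ _ s)) (λ N' p' → acc-inverse (k N' p') (⇝-▷ _ s))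
  step p sN sMN k (redex β) = sMN

Sn-β∧₁ : ∀ (M₁ M₂ : Tm n m) π → Sn (M₁ · π) → Sn M₂ → Sn (pair M₁ M₂ · (π₁ ∷ π))
Sn-β∧₁ M₁ M₂ π s₁ s₂ = acc λ r → step s₁ s₂ (reduct (pair M₁ M₂) (π₁ ∷ π) r)
  where
  step : ∀ {Y} → Sn (M₁ · π) → Sn M₂ → Reduct (pair M₁ M₂) (π₁ ∷ π) Y → Sn Y
  step (acc h) s₂ (head (ξ-pairₗ {M' = M₁'} r)) = Sn-β∧₁ M₁' M₂ π (h (·-▷ π r)) s₂
  step s₁ (acc h) (head (ξ-pairᵣ {N' = M₂'} r)) = Sn-β∧₁ M₁ M₂' π s₁ (h r)
  step (acc h) s₂ (stack (there {π' = π'} s))   = Sn-β∧₁ M₁ M₂ π' (h (⇝-▷ M₁ s)) s₂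
  step s₁ s₂ (redex β∧₁)                        = s₁

Sn-β∧₂ : ∀ (M₁ M₂ : Tm n m) π → Sn M₁ → Sn (M₂ · π) → Sn (pair M₁ M₂ · (π₂ ∷ π))
Sn-β∧₂ M₁ M₂ π s₁ s₂ = acc λ r → step s₁ s₂ (reduct (pair M₁ M₂) (π₂ ∷ π) r)
  where
  step : ∀ {Y} → Sn M₁ → Sn (M₂ · π) → Reduct (pair M₁ M₂) (π₂ ∷ π) Y → Sn Y
  step (acc h) s₂ (head (ξ-pairₗ {M' = M₁'} r)) = Sn-β∧₂ M₁' M₂ π (h r) s₂
  step s₁ (acc h) (head (ξ-pairᵣ {N' = M₂'} r)) = Sn-β∧₂ M₁ M₂' π s₁ (h (·-▷ π r))
  step s₁ (acc h) (stack (there {π' = π'} s))   = Sn-β∧₂ M₁ M₂ π' s₁ (h (⇝-▷ M₂ s))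
  step s₁ s₂ (redex β∧₂)                        = s₂

-- Sn T with T ≡ N₁ [0:= M ] · π, rather than Sn (N₁ [0:= M ] · π): a
-- commuting step only changes the equation, so the accessibility proof,
-- and with it the termination measure, stays the same.
Sn-β∨₁ : ∀ A (M : Tm n m) N₁ N₂ π → ⟦ A ⟧ M → SnInst A N₁ π → Sn (N₂ · map wkEᵢ π) →
  Sn (ω₁ M · (case N₁ N₂ ∷ π))
Sn-β∨₁ A M N₁ N₂ π p k s₂ = go M N₁ N₂ π p (⟦⟧⇒Sn A p) (k M p) refl s₂ k
  where
  go   : ∀ M N₁ N₂ π {T} → ⟦ A ⟧ M → Sn M → Sn T → T ≡ N₁ [0:= M ] · π →
    Sn (N₂ · map wkEᵢ π) → SnInst A N₁ π → Sn (ω₁ M · (case N₁ N₂ ∷ π))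
  step : ∀ {M N₁ N₂ π T Y} → ⟦ A ⟧ M → Sn M → Sn T → T ≡ N₁ [0:= M ] · π →
    Sn (N₂ · map wkEᵢ π) → SnInst A N₁ π → Reduct (ω₁ M) (case N₁ N₂ ∷ π) Y → Sn Y
  go M N₁ N₂ π p sM sT eq s₂ k = acc λ r → step p sM sT eq s₂ k (reduct _ (case N₁ N₂ ∷ π) r)
  step {N₁ = N₁} {N₂} {π} p (acc h) sT refl s₂ k (head (ξ-ω₁ {M' = M'} r)) =
    go M' N₁ N₂ π (⟦⟧-▷ A p r) (h r) (k M' (⟦⟧-▷ A p r)) refl s₂ k
  step {M} {N₂ = N₂} {π} p sM (acc h) refl s₂ k (stack (here (ξ-caseₗ {N₁' = N₁'} r))) =
    go M N₁' N₂ π p sM (h (·-▷ π ([0:=]-▷ M r))) refl s₂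
       (λ P p' → acc-inverse (k P p') (·-▷ π ([0:=]-▷ P r)))
  step {M} {N₁} {π = π} p sM sT eq (acc h) k (stack (here (ξ-caseᵣ {N₂' = N₂'} r))) =
    go M N₁ N₂' π p sM sT eq (h (·-▷ (map wkEᵢ π) r)) k
  step {M} {N₁} {N₂} p sM (acc h) refl (acc h₂) k (stack (there {π' = π'} s)) =
    go M N₁ N₂ π' p sM (h (⇝-▷ _ s)) refl (h₂ (⇝-▷ N₂ (renS-⇝ suc id s)))
       (λ P p' → acc-inverse (k P p') (⇝-▷ _ s))
  step {M} {N₁} {N₂} p sM sT refl s₂ k (stack (comm {ε = ε} {π})) =
    go M (app N₁ (wkEᵢ ε)) (app N₂ (wkEᵢ ε)) π p sM sT
       (cong (λ ε' → app (N₁ [0:= M ]) ε' · π) (sym (wkEᵢ-[0:=] M ε))) s₂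
       (λ P p' → subst (λ ε' → Sn (app (N₁ [0:= P ]) ε' · π)) (sym (wkEᵢ-[0:=] P ε)) (k P p'))
  step {M} p sM sT eq s₂ k (redex β∨₁) = k M p

Sn-β∨₂ : ∀ A (M : Tm n m) N₁ N₂ π → ⟦ A ⟧ M → SnInst A N₂ π → Sn (N₁ · map wkEᵢ π) →
  Sn (ω₂ M · (case N₁ N₂ ∷ π))
Sn-β∨₂ A M N₁ N₂ π p k s₁ = go M N₁ N₂ π p (⟦⟧⇒Sn A p) (k M p) refl s₁ k
  where
  go   : ∀ M N₁ N₂ π {T} → ⟦ A ⟧ M → Sn M → Sn T → T ≡ N₂ [0:= M ] · π →
    Sn (N₁ · map wkEᵢ π) → SnInst A N₂ π → Sn (ω₂ M · (case N₁ N₂ ∷ π))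
  step : ∀ {M N₁ N₂ π T Y} → ⟦ A ⟧ M → Sn M → Sn T → T ≡ N₂ [0:= M ] · π →
    Sn (N₁ · map wkEᵢ π) → SnInst A N₂ π → Reduct (ω₂ M) (case N₁ N₂ ∷ π) Y → Sn Y
  go M N₁ N₂ π p sM sT eq s₁ k = acc λ r → step p sM sT eq s₁ k (reduct _ (case N₁ N₂ ∷ π) r)
  step {N₁ = N₁} {N₂} {π} p (acc h) sT refl s₁ k (head (ξ-ω₂ {M' = M'} r)) =
    go M' N₁ N₂ π (⟦⟧-▷ A p r) (h r) (k M' (⟦⟧-▷ A p r)) refl s₁ k
  step {M} {N₂ = N₂} {π} p sM sT eq (acc h) k (stack (here (ξ-caseₗ {N₁' = N₁'} r))) =
    go M N₁' N₂ π p sM sT eq (h (·-▷ (map wkEᵢ π) r)) k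
  step {M} {N₁} {π = π} p sM (acc h) refl s₁ k (stack (here (ξ-caseᵣ {N₂' = N₂'} r))) =
    go M N₁ N₂' π p sM (h (·-▷ π ([0:=]-▷ M r))) refl s₁
       (λ P p' → acc-inverse (k P p') (·-▷ π ([0:=]-▷ P r)))
  step {M} {N₁} {N₂} p sM (acc h) refl (acc h₁) k (stack (there {π' = π'} s)) =
    go M N₁ N₂ π' p sM (h (⇝-▷ _ s)) refl (h₁ (⇝-▷ N₁ (renS-⇝ suc id s)))
       (λ P p' → acc-inverse (k P p') (⇝-▷ _ s))
  step {M} {N₁} {N₂} p sM sT refl s₁ k (stack (comm {ε = ε} {π})) =
    go M (app N₁ (wkEᵢ ε)) (app N₂ (wkEᵢ ε)) π p sM sT
       (cong (λ ε' → app (N₂ [0:= M ]) ε' · π) (sym (wkEᵢ-[0:=] M ε))) s₁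
       (λ P p' → subst (λ ε' → Sn (app (N₂ [0:= P ]) ε' · π)) (sym (wkEᵢ-[0:=] P ε)) (k P p'))
  step {M} p sM sT eq s₁ k (redex β∨₂) = k M p

-- Sn (H · map wkEᵢ π), for an arbitrary H, says that π is a strongly
-- normalising stack; when μ-reduction absorbs the first element ε of π, the
-- same proof serves for the rest of the stack with H replaced by app H (wkEᵢ ε).
Sn-μ : ∀ (M : Tm n (suc m)) π (H : Tm (suc n) m) → Sn (H · map wkEᵢ π) →
  (∀ π' → Star _⇝_ π π' → Sn (M [0:=* π' ])) → Sn (mu M · π)
Sn-μ M π H sH k = go M π H sH (k π ε*) refl k
  where
  go   : ∀ M π H {T} → Sn (H · map wkEᵢ π) → Sn T → T ≡ M [0:=* π ] →
    (∀ π' → Star _⇝_ π π' → Sn (M [0:=* π' ])) → Sn (mu M · π)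
  step : ∀ {M π H T Y} → Sn (H · map wkEᵢ π) → Sn T → T ≡ M [0:=* π ] →
    (∀ π' → Star _⇝_ π π' → Sn (M [0:=* π' ])) → Reduct (mu M) π Y → Sn Y
  go M π H sH sT eq k = acc λ r → step sH sT eq k (reduct (mu M) π r)
  step {π = π} {H} sH (acc h) refl k (head (ξ-mu {M' = M'} r)) =
    go M' π H sH (h (gsub-▷ var _ r)) refl (λ π' ss → acc-inverse (k π' ss) (gsub-▷ var _ r))
  step {M} {H = H} (acc h) sT eq k (stack {π' = π'} s) =
    go M π' H (h (⇝-▷ H (renS-⇝ suc id s))) (k π' (s ◅ ε*)) refl (λ π'' ss → k π'' (s ◅ ss))
  step {M} {H = H} sH sT eq k (redex {ε = ε} {π} μ-red) =
    go (ssubT zero (wkEc ε) M) π (app H (wkEᵢ ε)) sH sT (trans eq ([0:=*]-∷ ε π M))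
       (λ π' ss → subst Sn ([0:=*]-∷ ε π' M) (k (ε ∷ π') (gmap (ε ∷_) there ss)))

⟦⟧⊥⇒Sn : ∀ A {M : Tm n m} → ⟦ A ⟧⊥ M → Sn M
⟦⟧⊥⇒Sn A p = p [] tt

lam∈⟦⟧⊥ : ∀ A B {M : Tm (suc n) m} → Sn M → (∀ N → ⟦ A ⟧ N → ⟦ B ⟧⊥ (M [0:= N ])) →
  ⟦ A ⇒ B ⟧⊥ (lam M)
lam∈⟦⟧⊥ A B         sM k []             _       = Sn-lam sM
lam∈⟦⟧⊥ A B {M = M} sM k (arg N ∷ π)    (p , q) = Sn-β A M N π p (λ N' p' → k N' p' π q)
lam∈⟦⟧⊥ A B         sM k (π₁ ∷ π)       ()
lam∈⟦⟧⊥ A B         sM k (π₂ ∷ π)       ()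
lam∈⟦⟧⊥ A B         sM k (case _ _ ∷ π) ()

pair∈⟦⟧⊥ : ∀ A B {M N : Tm n m} → ⟦ A ⟧⊥ M → ⟦ B ⟧⊥ N → ⟦ A ∧′ B ⟧⊥ (pair M N)
pair∈⟦⟧⊥ A B         p q []             _  = Sn-pair (⟦⟧⊥⇒Sn A p) (⟦⟧⊥⇒Sn B q)
pair∈⟦⟧⊥ A B {M = M} {N} p q (π₁ ∷ π)   q' = Sn-β∧₁ M N π (p π q') (⟦⟧⊥⇒Sn B q)
pair∈⟦⟧⊥ A B {M = M} {N} p q (π₂ ∷ π)   q' = Sn-β∧₂ M N π (⟦⟧⊥⇒Sn A p) (q π q')
pair∈⟦⟧⊥ A B         p q (arg _ ∷ π)    ()
pair∈⟦⟧⊥ A B         p q (case _ _ ∷ π) ()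

ω₁∈⟦⟧⊥ : ∀ A B {M : Tm n m} → ⟦ A ⟧ M → ⟦ A ∨′ B ⟧⊥ (ω₁ M)
ω₁∈⟦⟧⊥ A B         p []                 _         = Sn-ω₁ (⟦⟧⇒Sn A p)
ω₁∈⟦⟧⊥ A B {M = M} p (case N₁ N₂ ∷ π)   (k₁ , k₂) =
  Sn-β∨₁ A M N₁ N₂ π p (Branch⇒SnInst A N₁ π k₁) (Branch⇒Sn B π k₂)
ω₁∈⟦⟧⊥ A B         p (arg _ ∷ π)        ()
ω₁∈⟦⟧⊥ A B         p (π₁ ∷ π)           ()
ω₁∈⟦⟧⊥ A B         p (π₂ ∷ π)           ()

ω₂∈⟦⟧⊥ : ∀ A B {M : Tm n m} → ⟦ B ⟧ M → ⟦ A ∨′ B ⟧⊥ (ω₂ M)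
ω₂∈⟦⟧⊥ A B         p []                 _         = Sn-ω₂ (⟦⟧⇒Sn B p)
ω₂∈⟦⟧⊥ A B {M = M} p (case N₁ N₂ ∷ π)   (k₁ , k₂) =
  Sn-β∨₂ B M N₁ N₂ π p (Branch⇒SnInst B N₂ π k₂) (Branch⇒Sn A π k₁)
ω₂∈⟦⟧⊥ A B         p (arg _ ∷ π)        ()
ω₂∈⟦⟧⊥ A B         p (π₁ ∷ π)           ()
ω₂∈⟦⟧⊥ A B         p (π₂ ∷ π)           ()

mu∈⟦⟧⊥ : ∀ A {M : Tm n (suc m)} → (∀ π → ⟦ A ⟧ˢ π → Sn (M [0:=* π ])) → ⟦ A ⟧⊥ (mu M)
mu∈⟦⟧⊥ A {M = M} k π q =
  Sn-μ M π (var zero) (⟦⟧⇒⟦⟧⊥ A (var∈⟦⟧ A zero) (map wkEᵢ π) (⟦⟧ˢ-renS A suc id π q))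
       (λ π' ss → k π' (⟦⟧ˢ-⇝* A q ss))

throw∈⟦⊥′⟧⊥ : ∀ {a : Fin m} {M : Tm n m} → Sn M → ⟦ ⊥′ ⟧⊥ (throw a M)
throw∈⟦⊥′⟧⊥ sM []      _  = Sn-throw sM
throw∈⟦⊥′⟧⊥ sM (_ ∷ _) ()

record RedSub (Γ : Vec Form n) (Δ : Vec Form m) (σ : Sub n n' m') (τ : ClSub m n' m') : Set where
  field
    terms  : ∀ x → ⟦ lookup Γ x ⟧ (σ x)
    stacks : ∀ a → ⟦ lookup Δ a ⟧ˢ (pending (τ a))
open RedSub

RedSub-id : (Γ : Vec Form n) (Δ : Vec Form m) → RedSub Γ Δ var idτ
RedSub-id Γ Δ = record { terms = λ x → var∈⟦⟧ (lookup Γ x) x ; stacks = λ a → tt }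

RedSub-ren : ∀ {Γ : Vec Form n} {Δ : Vec Form m} {σ : Sub n n' m'} {τ : ClSub m n' m'}
  (ρ : Ren n' n'') (θ : Ren m' m'') → RedSub Γ Δ σ τ → RedSub Γ Δ (renT ρ θ ∘ σ) (renCont ρ θ ∘ τ)
RedSub-ren {Γ = Γ} {Δ} {σ} {τ} ρ θ g = record
  { terms  = λ x → ⟦⟧-renT (lookup Γ x) ρ θ (terms g x)
  ; stacks = λ a → ⟦⟧ˢ-renS (lookup Δ a) ρ θ (pending (τ a)) (stacks g a) }

RedSub-∷ : ∀ {Γ : Vec Form n} {Δ : Vec Form m} {σ : Sub n n' m'} {τ : ClSub m n' m'} {A P} →
  ⟦ A ⟧ P → RedSub Γ Δ σ τ → RedSub (A ∷ Γ) Δ (P ∷ₛ σ) τ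
RedSub-∷ p g = record { terms = λ { zero → p ; (suc x) → terms g x } ; stacks = stacks g }

RedSub-exts : ∀ {Γ : Vec Form n} {Δ : Vec Form m} {σ : Sub n n' m'} {τ : ClSub m n' m'} {A} →
  RedSub Γ Δ σ τ → RedSub (A ∷ Γ) Δ (exts σ) (extτ τ)
RedSub-exts {A = A} g = record
  { terms  = λ { zero → var∈⟦⟧ A zero ; (suc x) → terms (RedSub-ren suc id g) x }
  ; stacks = stacks (RedSub-ren suc id g) }

RedSub-∷τ : ∀ {Γ : Vec Form n} {Δ : Vec Form m} {σ : Sub n n' m'} {τ : ClSub m n' m'} {A π} →
  ⟦ A ⟧ˢ π → RedSub Γ Δ σ τ → RedSub Γ (A ∷ Δ) (extsᶜ σ) (π ∷τ τ)
RedSub-∷τ {A = A} {π} q g = record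
  { terms  = terms (RedSub-ren id suc g)
  ; stacks = λ { zero → ⟦⟧ˢ-renS A id suc π q ; (suc a) → stacks (RedSub-ren id suc g) a } }

gsub-∷ₛ-exts : ∀ (σ : Sub n n' m') (τ : ClSub m n' m') (ρ : Ren n' n'') (θ : Ren m' m'') P N →
  gsub (P ∷ₛ var ∘ ρ) (renτ θ) (gsub (exts σ) (extτ τ) N) ≡
  gsub (P ∷ₛ renT ρ θ ∘ σ) (renCont ρ θ ∘ τ) N
gsub-∷ₛ-exts σ τ ρ θ P N =
  trans (gsub-gsub (P ∷ₛ var ∘ ρ) (renτ θ) (exts σ) (extτ τ) N) (gsub-cong terms≗ (conts≗ ∘ τ) N)
  where
  terms≗ : gsub (P ∷ₛ var ∘ ρ) (renτ θ) ∘ exts σ ≗ P ∷ₛ renT ρ θ ∘ σ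
  terms≗ zero    = refl
  terms≗ (suc x) = trans (gsub-renT (P ∷ₛ var ∘ ρ) (renτ θ) suc id (σ x)) (sym (renT≡gsub ρ θ (σ x)))
  conts≗ : ∀ c → gsubCont (P ∷ₛ var ∘ ρ) (renτ θ) (renCont suc id c) ≡ renCont ρ θ c
  conts≗ (b ▸ π) = cong (θ b ▸_) (trans (++-identityʳ _) (map-fuse (gsubₑ-∷ₛ-wkEᵢ ρ θ P) π))

adequacy⊥ : ∀ {Γ : Vec Form n} {Δ : Vec Form m} {M A} {σ : Sub n n' m'} {τ : ClSub m n' m'} →
  Γ ∣ Δ ⊢ M ∶ A → RedSub Γ Δ σ τ → ⟦ A ⟧⊥ (gsub σ τ M)
adequacy : ∀ {Γ : Vec Form n} {Δ : Vec Form m} {M A} {σ : Sub n n' m'} {τ : ClSub m n' m'} →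
  Γ ∣ Δ ⊢ M ∶ A → RedSub Γ Δ σ τ → ⟦ A ⟧ (gsub σ τ M)
adequacy-Branch : ∀ {Γ : Vec Form n} {Δ : Vec Form m} {N A C} {σ : Sub n n' m'} {τ : ClSub m n' m'} {π} →
  (A ∷ Γ) ∣ Δ ⊢ N ∶ C → RedSub Γ Δ σ τ → ⟦ C ⟧ˢ π → Branch A (gsub (exts σ) (extτ τ) N) π

adequacy {M = M} {A} {σ} {τ} d g ρ θ =
  subst ⟦ A ⟧⊥ (sym (renT-gsub ρ θ σ τ M)) (adequacy⊥ d (RedSub-ren ρ θ g))

adequacy-Branch {N = N} {C = C} {σ} {τ} {π} d g q ρ θ P p =
  subst (λ N' → Sn (N' · map (renE ρ θ) π)) (sym (gsub-∷ₛ-exts σ τ ρ θ P N))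
        (adequacy⊥ d (RedSub-∷ p (RedSub-ren ρ θ g)) (map (renE ρ θ) π) (⟦⟧ˢ-renS C ρ θ π q))

adequacy⊥ {Γ = Γ} (ax x) g        = ⟦⟧⇒⟦⟧⊥ (lookup Γ x) (terms g x)
adequacy⊥ (∧I {A = A} {B} d₁ d₂) g = pair∈⟦⟧⊥ A B (adequacy⊥ d₁ g) (adequacy⊥ d₂ g)
adequacy⊥ (∧E₁ d) g π q           = adequacy⊥ d g (π₁ ∷ π) q
adequacy⊥ (∧E₂ d) g π q           = adequacy⊥ d g (π₂ ∷ π) q
adequacy⊥ {σ = σ} {τ} (⇒I {M} {A} {B} d) g =
  lam∈⟦⟧⊥ A B (⟦⟧⊥⇒Sn B (adequacy⊥ d (RedSub-exts g)))
    (λ N p → subst ⟦ B ⟧⊥ (sym (gsub-exts-[0:=] σ τ M N)) (adequacy⊥ d (RedSub-∷ p g)))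
adequacy⊥ (⇒E d₁ d₂) g π q        = adequacy⊥ d₁ g (arg _ ∷ π) (adequacy d₂ g , q)
adequacy⊥ (∨I₁ {A = A} {B} d) g   = ω₁∈⟦⟧⊥ A B (adequacy d g)
adequacy⊥ (∨I₂ {A = A} {B} d) g   = ω₂∈⟦⟧⊥ A B (adequacy d g)
adequacy⊥ (∨E d d₁ d₂) g π q      =
  adequacy⊥ d g (case _ _ ∷ π) (adequacy-Branch {π = π} d₁ g q , adequacy-Branch {π = π} d₂ g q)
adequacy⊥ {σ = σ} {τ} (μI {M} {A} d) g =
  mu∈⟦⟧⊥ A λ π q →
    subst Sn (sym (gsub-extsᶜ-[0:=*] σ τ M π)) (⟦⟧⊥⇒Sn ⊥′ (adequacy⊥ d (RedSub-∷τ q g)))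
adequacy⊥ {τ = τ} (μE a d) g     = throw∈⟦⊥′⟧⊥ (adequacy⊥ d g (pending (τ a)) (stacks g a))

theorem2p2 : ∀ {n m : ℕ} (Γ : Vec Form n) (Δ : Vec Form m) (M : Tm n m) (A : Form) →
    Γ ∣ Δ ⊢ M ∶ A → SN M
theorem2p2 Γ Δ M A d = Sn⇒SN (subst Sn (gsub-id M) (⟦⟧⊥⇒Sn A (adequacy⊥ d (RedSub-id Γ Δ))))
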